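{- A real $X\in\{0,1\}^\omega$ is $\mathrm{BP}$ random if and only if it is prefix-free $\mathrm{BP}$ random.
   Context: For a finite string $\sigma$, $[\sigma]$ is the set of reals extending $\sigma$, and $[G]=\bigcup_{\sigma\in G}[\sigma]$. $\mu$ is the uniform measure. $X\upharpoonright n$ is the length-$n$ initial segment of $X$. A primitive recursive test is a sequence of clopen sets $U_n=[G_n]$, with $G_n$ finite sets of strings given by a primitive recursive function and $\mu(U_n)\le2^{ -n}$. $X$ is $\mathrm{BP}$ random if for every primitive recursive test there is $n$ with $X\notin U_n$. Partial primitive recursive functions are handled by allowing a primitive recursive $M$ to output a special symbol $\infty$, meaning "diverges". Such an $M:\{0,1\}^*\to\{0,1\}^*\cup\{\infty\}$ is prefix-free if there are no distinct strings $\sigma\sqsubset\tau$ with both $M(\sigma)\ne\infty$ and $M(\tau)\ne\infty$. $C_M(\tau)$ is the least $|\sigma|$ with $M(\sigma)=\tau$. $X$ is prefix-free $\mathrm{BP}$ random if there do not exist a prefix-free primitive recursive $M$ and a primitive recursive $f$ such that $C_M(X\upharpoonright f(c))\le f(c)-c$ for all $c$. -}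

module Defs where

open import Data.Nat using (ℕ; zero; suc; _+_; _*_; _^_; _≤_; ⌊_/2⌋)
open import Data.Bool using (Bool; true; false; not; if_then_else_; _∨_)
open import Data.Fin using (Fin)
open import Data.Vec using (Vec; []; _∷_; lookup)
open import Data.List using (List; []; _∷_; _++_; length; map; upTo; inits; filterᵇ; concatMap)
open import Data.Product using (Σ; _×_; _,_; ∃)
open import Relation.Binary.PropositionalEquality using (_≡_; _≢_)
open import Relation.Nullary using (¬_)
open import Data.Bool.ListAction using (any)

data PR : ℕ → Set where
  zeroF : ∀ {k} → PR k
  succF : PR 1
  proj  : ∀ {k} → Fin k → PR k
  comp  : ∀ {k m} → PR m → Vec (PR k) m → PR k
  prec  : ∀ {k} → PR k → PR (suc (suc k)) → PR (suc k)

mutual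
  eval : ∀ {k} → PR k → Vec ℕ k → ℕ
  eval zeroF      xs       = 0
  eval succF      (x ∷ []) = suc x
  eval (proj i)   xs       = lookup xs i
  eval (comp f gs) xs      = eval f (evalVec gs xs)
  eval (prec f g) (zero ∷ xs)  = eval f xs
  eval (prec f g) (suc n ∷ xs) = eval g (n ∷ eval (prec f g) (n ∷ xs) ∷ xs)

  evalVec : ∀ {k m} → Vec (PR k) m → Vec ℕ k → Vec ℕ m
  evalVec []       xs = []
  evalVec (g ∷ gs) xs = eval g xs ∷ evalVec gs xs

⟦_⟧₁ : PR 1 → ℕ → ℕ
⟦ f ⟧₁ n = eval f (n ∷ [])

Str : Set
Str = List Bool

Real : Set
Real = ℕ → Bool

-- bijection Str → ℕ :  [] ↦ 0, false ∷ σ ↦ 2·#σ+1, true ∷ σ ↦ 2·#σ+2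
encode : Str → ℕ
encode []          = 0
encode (false ∷ σ) = suc (2 * encode σ)
encode (true ∷ σ)  = suc (suc (2 * encode σ))

_↾_ : Real → ℕ → Str
X ↾ n = map X (upTo n)

-- Finite sets of strings, coded by canonical indices:
-- the set with code k contains σ iff bit number (encode σ) of k is 1.

isOdd : ℕ → Bool
isOdd zero    = false
isOdd (suc n) = not (isOdd n)

bit : ℕ → ℕ → Bool
bit k zero    = isOdd k
bit k (suc i) = bit ⌊ k /2⌋ i

_∈D_ : Str → ℕ → Set
σ ∈D k = bit k (encode σ) ≡ true

_∈[D_] : Real → ℕ → Set
X ∈[D k ] = Σ Str λ σ → σ ∈D k × (X ↾ length σ ≡ σ)

strings : ℕ → List Str
strings zero    = [] ∷ []
strings (suc L) = concatMap (λ τ → (false ∷ τ) ∷ (true ∷ τ) ∷ []) (strings L)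

cylCount : ℕ → ℕ → ℕ
cylCount k L = length (filterᵇ (λ τ → any (λ ρ → bit k (encode ρ)) (inits τ)) (strings L))

-- μ([G]) ≤ 2^{-n}: for any L bounding the lengths of the strings in G,
-- μ([G]) = cylCount k L / 2^L, so the condition is cylCount k L · 2^n ≤ 2^L.
MeasureLE : ℕ → ℕ → Set
MeasureLE k n = ∀ L → (∀ σ → σ ∈D k → length σ ≤ L) → cylCount k L * 2 ^ n ≤ 2 ^ L

-- g n is the canonical index of G_n, U_n = [G_n]
IsPRTest : PR 1 → Set
IsPRTest g = ∀ n → MeasureLE (⟦ g ⟧₁ n) n

-- X passes the test: X ∉ U_n for some n (stated classically as ¬ ∀ n, X ∈ U_n)
BPRandom : Real → Set
BPRandom X = ∀ g → IsPRTest g → ¬ (∀ n → X ∈[D ⟦ g ⟧₁ n ])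

-- Prefix-free primitive recursive machines.
-- M is given by a unary PR function m on codes: m(encode σ) = 0 means
-- M(σ) = ∞ (diverges), m(encode σ) = suc (encode τ) means M(σ) = τ.

Converges : PR 1 → Str → Set
Converges m σ = ⟦ m ⟧₁ (encode σ) ≢ 0

Outputs : PR 1 → Str → Str → Set
Outputs m σ τ = ⟦ m ⟧₁ (encode σ) ≡ suc (encode τ)

PrefixFree : PR 1 → Set
PrefixFree m = ∀ σ ρ → σ ≢ σ ++ ρ → ¬ (Converges m σ × Converges m (σ ++ ρ))

-- C_M(τ) ≤ f(c) − c   (false if C_M(τ) is undefined or f(c) < c)
CBound : PR 1 → Str → ℕ → ℕ → Set
CBound m τ fc c = Σ Str λ σ → Outputs m σ τ × (length σ + c ≤ fc)

PFBPRandom : Real → Set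
PFBPRandom X = ¬ (Σ (PR 1) λ m → PrefixFree m × Σ (PR 1) λ f →
                   ∀ c → CBound m (X ↾ ⟦ f ⟧₁ c) (⟦ f ⟧₁ c) c)

-- Given a prefix-free machine M and f with C_M(X ↾ f c) ≤ f c − c for all c, let G_n be the set of strings of
-- length f n that have an M-program of length ≤ f n − n. Replacing the first f n bits of a string in [G_n] by such a
-- program, padded to length f n − n, is injective because M is prefix-free; so at most 2^(L−n) of the strings of
-- any length L lie in [G_n], and (G_n) is a primitive recursive test that X fails.
-- Conversely, given a test (G_n) that X fails, let K c be the canonical index of G_{2c+2}: it bounds the lengths of
-- the strings of G_{2c+2}, so at most 2^(K c) strings of length L c = K c + 2c + 2 lie in [G_{2c+2}]. The machine
-- sends 1^c 0 u with |u| = K c to the rank(u)-th of them. These programs form a prefix-free set, and X ↾ L c, which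
-- lies in [G_{2c+2}], gets a program of length L c − c − 1.
-- All functions involved are given by arithmetic expressions with bounded sums, which compile to primitive
-- recursive terms.

module Submission where

open import Defs
open import Data.Nat
  using (ℕ; zero; suc; _+_; _*_; _∸_; _^_; _≤_; _<_; pred; ⌊_/2⌋; z≤n; s≤s; s≤s⁻¹; z<s; _≟_; _≤?_; _<?_)
open import Data.Nat.Properties
open import Data.Nat.Tactic.RingSolver using (solve-∀)
open import Data.Bool using (Bool; true; false; not; _∨_)
import Data.Bool as Bool
open import Data.Bool.Properties using (not-involutive; ∨-zeroʳ)
open import Data.Bool.ListAction using (any)
open import Data.Empty using (⊥-elim)
open import Data.Fin using (Fin; zero; suc)
import Data.Fin as Fin
open import Data.Vec using (Vec; []; _∷_; lookup; tabulate)
open import Data.Vec.Properties using (tabulate∘lookup)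
open import Data.List using (List; []; _∷_; _++_; length; map; upTo; inits; filterᵇ; concatMap; take; drop; replicate)
open import Data.List.Properties
  using (length-++; length-drop; length-replicate; length-map; length-upTo; ++-cancelˡ; ++-identityʳ; ++-assoc;
         take++drop≡id; map-++; upTo-∷ʳ; ∷-injective; ≡-dec)
open import Data.Product using (Σ; _×_; _,_; proj₁; proj₂)
open import Data.Sum using (_⊎_; inj₁; inj₂)
open import Function using (_∘_)
open import Function.Bundles using (_⇔_; mk⇔; Equivalence)
open import Relation.Nullary using (¬_; Dec; yes; no; contradiction)
open import Relation.Binary.PropositionalEquality

∑< : ℕ → (ℕ → ℕ) → ℕ
∑< zero    h = 0
∑< (suc n) h = ∑< n h + h n

∑<-cong : ∀ n {h h′ : ℕ → ℕ} → (∀ i → i < n → h i ≡ h′ i) → ∑< n h ≡ ∑< n h′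
∑<-cong zero    eq = refl
∑<-cong (suc n) eq = cong₂ _+_ (∑<-cong n (λ i i<n → eq i (m<n⇒m<1+n i<n))) (eq n ≤-refl)

∑<-zero : ∀ n {h} → (∀ i → i < n → h i ≡ 0) → ∑< n h ≡ 0
∑<-zero zero    eq = refl
∑<-zero (suc n) eq = cong₂ _+_ (∑<-zero n (λ i i<n → eq i (m<n⇒m<1+n i<n))) (eq n ≤-refl)

∑<-ones : ∀ n {h} → (∀ i → i < n → h i ≡ 1) → ∑< n h ≡ n
∑<-ones zero    eq = refl
∑<-ones (suc n) eq = trans (cong₂ _+_ (∑<-ones n (λ i i<n → eq i (m<n⇒m<1+n i<n))) (eq n ≤-refl)) (+-comm n 1)

∑<-single : ∀ n {h} j → j < n → (∀ i → i < n → i ≢ j → h i ≡ 0) → ∑< n h ≡ h j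
∑<-single (suc n) {h} j j<1+n eq with m≤n⇒m<n∨m≡n (s≤s⁻¹ j<1+n)
... | inj₁ j<n  = trans (cong₂ _+_ (∑<-single n j j<n (λ i i<n → eq i (m<n⇒m<1+n i<n)))
                                   (eq n ≤-refl (λ n≡j → <-irrefl (sym n≡j) j<n)))
                        (+-identityʳ _)
... | inj₂ refl = cong (_+ h n) (∑<-zero n (λ i i<n → eq i (m<n⇒m<1+n i<n) (<⇒≢ i<n)))

∑<-tail : ∀ m n {h} → m ≤ n → (∀ i → m ≤ i → i < n → h i ≡ 0) → ∑< n h ≡ ∑< m h
∑<-tail m n       m≤n eq with m≤n⇒m<n∨m≡n m≤n
∑<-tail m (suc n) _   eq | inj₁ m<1+n =
  trans (cong₂ _+_ (∑<-tail m n (s≤s⁻¹ m<1+n) (λ i m≤i i<n → eq i m≤i (m<n⇒m<1+n i<n)))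
                   (eq n (s≤s⁻¹ m<1+n) ≤-refl))
        (+-identityʳ _)
∑<-tail m n       _   eq | inj₂ refl = refl

term≤∑< : ∀ n h {i} → i < n → h i ≤ ∑< n h
term≤∑< (suc n) h {i} i<1+n with m≤n⇒m<n∨m≡n (s≤s⁻¹ i<1+n)
... | inj₁ i<n  = ≤-trans (term≤∑< n h i<n) (m≤m+n _ _)
... | inj₂ refl = m≤n+m _ _

∑<-mono-bound : ∀ {m n} h → m ≤ n → ∑< m h ≤ ∑< n h
∑<-mono-bound {m} {n} h m≤n with m≤n⇒m<n∨m≡n m≤n
∑<-mono-bound {m} {suc n} h _ | inj₁ m<1+n = ≤-trans (∑<-mono-bound h (s≤s⁻¹ m<1+n)) (m≤m+n _ _)
∑<-mono-bound         h _ | inj₂ refl  = ≤-refl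

∑<>0⇒term>0 : ∀ n h → 0 < ∑< n h → Σ ℕ λ i → i < n × 0 < h i
∑<>0⇒term>0 (suc n) h pos with h n in hn
... | suc _ = n , ≤-refl , subst (0 <_) (sym hn) z<s
... | zero with ∑<>0⇒term>0 n h (subst (0 <_) (+-identityʳ (∑< n h)) pos)
...   | i , i<n , hi>0 = i , m<n⇒m<1+n i<n , hi>0

∑<-shift : ∀ n h → ∑< (suc n) h ≡ h 0 + ∑< n (λ i → h (suc i))
∑<-shift zero    h = +-comm 0 (h 0)
∑<-shift (suc n) h = trans (cong (_+ h (suc n)) (∑<-shift n h)) (+-assoc (h 0) _ _)

∑<-distrib-+ : ∀ n f g → ∑< n f + ∑< n g ≡ ∑< n (λ i → f i + g i)
∑<-distrib-+ zero    f g = refl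
∑<-distrib-+ (suc n) f g =
  trans (interchange (∑< n f) (f n) (∑< n g) (g n)) (cong (_+ (f n + g n)) (∑<-distrib-+ n f g))
  where interchange : ∀ a b c d → (a + b) + (c + d) ≡ (a + c) + (b + d)
        interchange = solve-∀

*-distribˡ-∑< : ∀ a n h → a * ∑< n h ≡ ∑< n (λ i → a * h i)
*-distribˡ-∑< a zero    h = *-zeroʳ a
*-distribˡ-∑< a (suc n) h = trans (*-distribˡ-+ a (∑< n h) (h n)) (cong (_+ a * h n) (*-distribˡ-∑< a n h))

∑<-pairs : ∀ n h → ∑< (2 * n) h ≡ ∑< n (λ i → h (2 * i) + h (suc (2 * i)))
∑<-pairs zero    h = refl
∑<-pairs (suc n) h = begin
  ∑< (2 * suc n) h
    ≡⟨ cong (λ m → ∑< m h) (*-suc 2 n) ⟩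
  ∑< (2 * n) h + h (2 * n) + h (suc (2 * n))
    ≡⟨ +-assoc (∑< (2 * n) h) _ _ ⟩
  ∑< (2 * n) h + (h (2 * n) + h (suc (2 * n)))
    ≡⟨ cong (_+ (h (2 * n) + h (suc (2 * n)))) (∑<-pairs n h) ⟩
  ∑< n (λ i → h (2 * i) + h (suc (2 * i))) + (h (2 * n) + h (suc (2 * n)))
    ∎
  where open ≡-Reasoning

search : ∀ {P : ℕ → Set} → (∀ s → Dec (P s)) → ℕ → ℕ
search P? zero    = 0
search P? (suc B) with P? 0
... | yes _ = 0
... | no  _ = suc (search (λ s → P? (suc s)) B)

search-correct : ∀ {P : ℕ → Set} (P? : ∀ s → Dec (P s)) B {s} → s < B → P s → search P? B < B × P (search P? B)
search-correct P? (suc B) {s} s<B Ps with P? 0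
... | yes P0 = z<s , P0
search-correct P? (suc B) {zero}  s<B Ps | no ¬P0 = contradiction Ps ¬P0
search-correct P? (suc B) {suc s} s<B Ps | no ¬P0 with search-correct (λ s → P? (suc s)) B (s≤s⁻¹ s<B) Ps
... | found<B , found = s≤s found<B , found

toℕ : Bool → ℕ
toℕ false = 0
toℕ true  = 1

toℕ≤1 : ∀ b → toℕ b ≤ 1
toℕ≤1 false = z≤n
toℕ≤1 true  = s≤s z≤n

toℕ>0⇒true : ∀ {b} → 0 < toℕ b → b ≡ true
toℕ>0⇒true {true} _ = refl

1∸toℕ : ∀ b → 1 ∸ toℕ b ≡ toℕ (not b)
1∸toℕ false = refl
1∸toℕ true  = refl

⌊suc/2⌋ : ∀ n → ⌊ suc n /2⌋ ≡ ⌊ n /2⌋ + toℕ (isOdd n)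
⌊suc/2⌋ zero          = refl
⌊suc/2⌋ (suc zero)    = refl
⌊suc/2⌋ (suc (suc n)) = cong suc (trans (⌊suc/2⌋ n) (cong (λ b → ⌊ n /2⌋ + toℕ b) (sym (not-involutive (isOdd n)))))

-- Primitive recursive functions given by expressions

infixl 6 _⊕_ _⊖_
infixl 7 _⊗_

data Expr (k : ℕ) : Set where
  var         : Fin k → Expr k
  lit         : ℕ → Expr k
  _⊕_ _⊗_ _⊖_ : Expr k → Expr k → Expr k
  app         : PR 1 → Expr k → Expr k
  pow2        : Expr k → Expr k
  bitᴱ        : Expr k → Expr k → Expr k
  sum         : Expr k → Expr (suc k) → Expr k

⟦_⟧ᴱ : ∀ {k} → Expr k → Vec ℕ k → ℕ
⟦ var i    ⟧ᴱ xs = lookup xs i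
⟦ lit n    ⟧ᴱ xs = n
⟦ a ⊕ b    ⟧ᴱ xs = ⟦ a ⟧ᴱ xs + ⟦ b ⟧ᴱ xs
⟦ a ⊗ b    ⟧ᴱ xs = ⟦ a ⟧ᴱ xs * ⟦ b ⟧ᴱ xs
⟦ a ⊖ b    ⟧ᴱ xs = ⟦ a ⟧ᴱ xs ∸ ⟦ b ⟧ᴱ xs
⟦ app m a  ⟧ᴱ xs = ⟦ m ⟧₁ (⟦ a ⟧ᴱ xs)
⟦ pow2 a   ⟧ᴱ xs = 2 ^ ⟦ a ⟧ᴱ xs
⟦ bitᴱ k p ⟧ᴱ xs = toℕ (bit (⟦ k ⟧ᴱ xs) (⟦ p ⟧ᴱ xs))
⟦ sum b h  ⟧ᴱ xs = ∑< (⟦ b ⟧ᴱ xs) (λ i → ⟦ h ⟧ᴱ (i ∷ xs))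

module PrimitiveRecursivePrograms where

  add : PR 2
  add = prec (proj zero) (comp succF (proj (suc zero) ∷ []))

  add-correct : ∀ x y → eval add (x ∷ y ∷ []) ≡ x + y
  add-correct zero    y = refl
  add-correct (suc x) y = cong suc (add-correct x y)

  mul : PR 2
  mul = prec zeroF (comp add (proj (suc (suc zero)) ∷ proj (suc zero) ∷ []))

  mul-correct : ∀ x y → eval mul (x ∷ y ∷ []) ≡ x * y
  mul-correct zero    y = refl
  mul-correct (suc x) y = trans (add-correct y _) (cong (y +_) (mul-correct x y))

  predecessor : PR 1
  predecessor = prec zeroF (proj zero)

  predecessor-correct : ∀ x → eval predecessor (x ∷ []) ≡ pred x
  predecessor-correct zero    = refl
  predecessor-correct (suc x) = refl

  monus : PR 2
  monus = prec (proj zero) (comp predecessor (proj (suc zero) ∷ []))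

  monus-correct : ∀ y x → eval monus (y ∷ x ∷ []) ≡ x ∸ y
  monus-correct zero    x = refl
  monus-correct (suc y) x = begin
    eval predecessor (eval monus (y ∷ x ∷ []) ∷ []) ≡⟨ predecessor-correct (eval monus (y ∷ x ∷ [])) ⟩
    pred (eval monus (y ∷ x ∷ []))                  ≡⟨ cong pred (monus-correct y x) ⟩
    pred (x ∸ y)                                    ≡⟨ pred[m∸n]≡m∸[1+n] x y ⟩
    x ∸ suc y                                       ∎
    where open ≡-Reasoning

  const : ∀ {k} → ℕ → PR k
  const zero    = zeroF
  const (suc n) = comp succF (const n ∷ [])

  const-correct : ∀ {k} n (xs : Vec ℕ k) → eval (const n) xs ≡ n
  const-correct zero    xs = refl
  const-correct (suc n) xs = cong suc (const-correct n xs)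

  projections : ∀ {k m} → (Fin k → Fin m) → Vec (PR m) k
  projections ρ = tabulate (λ i → proj (ρ i))

  projections-correct : ∀ {k m} (ρ : Fin k → Fin m) (ys : Vec ℕ m) →
                        evalVec (projections ρ) ys ≡ tabulate (λ i → lookup ys (ρ i))
  projections-correct {zero}  ρ ys = refl
  projections-correct {suc k} ρ ys = cong (lookup ys (ρ zero) ∷_) (projections-correct (λ i → ρ (suc i)) ys)

  identity : ∀ {k} → Vec (PR k) k
  identity = projections (λ i → i)

  identity-correct : ∀ {k} (xs : Vec ℕ k) → evalVec identity xs ≡ xs
  identity-correct xs = trans (projections-correct (λ i → i) xs) (tabulate∘lookup xs)

  dropTwo : ∀ {k} → Vec (PR (suc (suc k))) k
  dropTwo = projections (λ i → suc (suc i))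

  dropTwo-correct : ∀ {k} a b (xs : Vec ℕ k) → evalVec dropTwo (a ∷ b ∷ xs) ≡ xs
  dropTwo-correct a b xs = trans (projections-correct (λ i → suc (suc i)) (a ∷ b ∷ xs)) (tabulate∘lookup xs)

  pow2P : PR 1
  pow2P = prec (const 1) (comp add (proj (suc zero) ∷ proj (suc zero) ∷ []))

  pow2P-correct : ∀ n → eval pow2P (n ∷ []) ≡ 2 ^ n
  pow2P-correct zero    = refl
  pow2P-correct (suc n) = begin
    eval add (P ∷ P ∷ []) ≡⟨ add-correct P P ⟩
    P + P                 ≡⟨ cong₂ _+_ (pow2P-correct n) (pow2P-correct n) ⟩
    2 ^ n + 2 ^ n         ≡⟨ cong (2 ^ n +_) (sym (+-identityʳ (2 ^ n))) ⟩
    2 ^ suc n             ∎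
    where open ≡-Reasoning
          P = eval pow2P (n ∷ [])

  parity : PR 1
  parity = prec zeroF (comp monus (proj (suc zero) ∷ const 1 ∷ []))

  parity-correct : ∀ n → eval parity (n ∷ []) ≡ toℕ (isOdd n)
  parity-correct zero    = refl
  parity-correct (suc n) = begin
    eval monus (eval parity (n ∷ []) ∷ eval (const 1) (n ∷ eval parity (n ∷ []) ∷ []) ∷ [])
      ≡⟨ monus-correct (eval parity (n ∷ [])) 1 ⟩
    1 ∸ eval parity (n ∷ [])
      ≡⟨ cong (1 ∸_) (parity-correct n) ⟩
    1 ∸ toℕ (isOdd n)
      ≡⟨ 1∸toℕ (isOdd n) ⟩
    toℕ (isOdd (suc n))
      ∎
    where open ≡-Reasoning

  half : PR 1
  half = prec zeroF (comp add (proj (suc zero) ∷ comp parity (proj zero ∷ []) ∷ []))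

  half-correct : ∀ n → eval half (n ∷ []) ≡ ⌊ n /2⌋
  half-correct zero    = refl
  half-correct (suc n) = begin
    eval add (eval half (n ∷ []) ∷ eval parity (n ∷ []) ∷ []) ≡⟨ add-correct (eval half (n ∷ [])) _ ⟩
    eval half (n ∷ []) + eval parity (n ∷ [])                 ≡⟨ cong₂ _+_ (half-correct n) (parity-correct n) ⟩
    ⌊ n /2⌋ + toℕ (isOdd n)                                   ≡⟨ ⌊suc/2⌋ n ⟨
    ⌊ suc n /2⌋                                               ∎
    where open ≡-Reasoning

  halvings : PR 2
  halvings = prec (proj zero) (comp half (proj (suc zero) ∷ []))

  halvings-suc : ∀ p k → eval halvings (suc p ∷ k ∷ []) ≡ eval halvings (p ∷ ⌊ k /2⌋ ∷ [])
  halvings-suc zero    k = half-correct k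
  halvings-suc (suc p) k = trans (half-correct (eval halvings (suc p ∷ k ∷ [])))
                                 (trans (cong ⌊_/2⌋ (halvings-suc p k)) (sym (half-correct _)))

  boundedSum : ∀ {k} → PR (suc k) → PR (suc k)
  boundedSum h = prec zeroF (comp add (proj (suc zero) ∷ comp h (proj zero ∷ dropTwo) ∷ []))

  boundedSum-correct : ∀ {k} (h : PR (suc k)) n (xs : Vec ℕ k) →
                       eval (boundedSum h) (n ∷ xs) ≡ ∑< n (λ i → eval h (i ∷ xs))
  boundedSum-correct h zero    xs = refl
  boundedSum-correct h (suc n) xs = trans (add-correct (eval (boundedSum h) (n ∷ xs)) _)
    (cong₂ _+_ (boundedSum-correct h n xs) (cong (λ ys → eval h (n ∷ ys)) (dropTwo-correct n _ xs)))

  bitP : PR 2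
  bitP = comp parity (halvings ∷ [])

  bitP-correct : ∀ p k → eval bitP (p ∷ k ∷ []) ≡ toℕ (bit k p)
  bitP-correct zero    k = parity-correct k
  bitP-correct (suc p) k = trans (cong (λ h → eval parity (h ∷ [])) (halvings-suc p k)) (bitP-correct p ⌊ k /2⌋)

open PrimitiveRecursivePrograms

compile : ∀ {k} → Expr k → PR k
compile (var i)    = proj i
compile (lit n)    = const n
compile (a ⊕ b)    = comp add (compile a ∷ compile b ∷ [])
compile (a ⊗ b)    = comp mul (compile a ∷ compile b ∷ [])
compile (a ⊖ b)    = comp monus (compile b ∷ compile a ∷ [])
compile (app m a)  = comp m (compile a ∷ [])
compile (pow2 a)   = comp pow2P (compile a ∷ [])
compile (bitᴱ k p) = comp bitP (compile p ∷ compile k ∷ [])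
compile (sum b h)  = comp (boundedSum (compile h)) (compile b ∷ identity)

compile-correct : ∀ {k} (e : Expr k) (xs : Vec ℕ k) → eval (compile e) xs ≡ ⟦ e ⟧ᴱ xs
compile-correct (var i)    xs = refl
compile-correct (lit n)    xs = const-correct n xs
compile-correct (a ⊕ b)    xs =
  trans (add-correct (eval (compile a) xs) _) (cong₂ _+_ (compile-correct a xs) (compile-correct b xs))
compile-correct (a ⊗ b)    xs =
  trans (mul-correct (eval (compile a) xs) _) (cong₂ _*_ (compile-correct a xs) (compile-correct b xs))
compile-correct (a ⊖ b)    xs =
  trans (monus-correct (eval (compile b) xs) _) (cong₂ _∸_ (compile-correct a xs) (compile-correct b xs))
compile-correct (app m a)  xs = cong ⟦ m ⟧₁ (compile-correct a xs)
compile-correct (pow2 a)   xs = trans (pow2P-correct (eval (compile a) xs)) (cong (2 ^_) (compile-correct a xs))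
compile-correct (bitᴱ k p) xs = trans (bitP-correct (eval (compile p) xs) (eval (compile k) xs))
                                      (cong₂ (λ p k → toℕ (bit k p)) (compile-correct p xs) (compile-correct k xs))
compile-correct (sum b h)  xs = begin
  eval (boundedSum (compile h)) (eval (compile b) xs ∷ evalVec identity xs)
    ≡⟨ cong (λ ys → eval (boundedSum (compile h)) (eval (compile b) xs ∷ ys)) (identity-correct xs) ⟩
  eval (boundedSum (compile h)) (eval (compile b) xs ∷ xs)
    ≡⟨ boundedSum-correct (compile h) (eval (compile b) xs) xs ⟩
  ∑< (eval (compile b) xs) (λ i → eval (compile h) (i ∷ xs))
    ≡⟨ ∑<-cong (eval (compile b) xs) (λ i _ → compile-correct h (i ∷ xs)) ⟩
  ∑< (eval (compile b) xs) (λ i → ⟦ h ⟧ᴱ (i ∷ xs))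
    ≡⟨ cong (λ n → ∑< n (λ i → ⟦ h ⟧ᴱ (i ∷ xs))) (compile-correct b xs) ⟩
  ∑< (⟦ b ⟧ᴱ xs) (λ i → ⟦ h ⟧ᴱ (i ∷ xs))
    ∎
  where open ≡-Reasoning

rename : ∀ {k k′} → (Fin k → Fin k′) → Expr k → Expr k′
rename ρ (var i)    = var (ρ i)
rename ρ (lit n)    = lit n
rename ρ (a ⊕ b)    = rename ρ a ⊕ rename ρ b
rename ρ (a ⊗ b)    = rename ρ a ⊗ rename ρ b
rename ρ (a ⊖ b)    = rename ρ a ⊖ rename ρ b
rename ρ (app m a)  = app m (rename ρ a)
rename ρ (pow2 a)   = pow2 (rename ρ a)
rename ρ (bitᴱ k p) = bitᴱ (rename ρ k) (rename ρ p)
rename ρ (sum b h)  = sum (rename ρ b) (rename (Fin.lift 1 ρ) h)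

weaken : ∀ {k} → Expr k → Expr (suc k)
weaken = rename suc

χ≤ : ℕ → ℕ → ℕ
χ≤ x y = 1 ∸ (x ∸ y)

χ≡ : ℕ → ℕ → ℕ
χ≡ x y = 1 ∸ ((x ∸ y) + (y ∸ x))

sg : ℕ → ℕ
sg x = 1 ∸ (1 ∸ x)

χ≤ᴱ χ≡ᴱ : ∀ {k} → Expr k → Expr k → Expr k
χ≤ᴱ a b = lit 1 ⊖ (a ⊖ b)
χ≡ᴱ a b = lit 1 ⊖ ((a ⊖ b) ⊕ (b ⊖ a))

sgᴱ : ∀ {k} → Expr k → Expr k
sgᴱ a = lit 1 ⊖ (lit 1 ⊖ a)

1∸n>0⇒n≡0 : ∀ x → 0 < 1 ∸ x → x ≡ 0
1∸n>0⇒n≡0 zero    _ = refl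
1∸n>0⇒n≡0 (suc x) p = ⊥-elim (<-irrefl (sym (0∸n≡0 x)) p)

n>0⇒1∸n≡0 : ∀ x → 0 < x → 1 ∸ x ≡ 0
n>0⇒1∸n≡0 (suc x) _ = 0∸n≡0 x

≤⇒χ≤≡1 : ∀ {x y} → x ≤ y → χ≤ x y ≡ 1
≤⇒χ≤≡1 x≤y = cong (1 ∸_) (m≤n⇒m∸n≡0 x≤y)

≰⇒χ≤≡0 : ∀ {x y} → ¬ x ≤ y → χ≤ x y ≡ 0
≰⇒χ≤≡0 {x} {y} x≰y = n>0⇒1∸n≡0 (x ∸ y) (n≢0⇒n>0 (m>n⇒m∸n≢0 (≰⇒> x≰y)))

χ≤>0⇒≤ : ∀ x y → 0 < χ≤ x y → x ≤ y
χ≤>0⇒≤ x y p = m∸n≡0⇒m≤n (1∸n>0⇒n≡0 (x ∸ y) p)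

m∸n+n∸m≡0⇒m≡n : ∀ x y → (x ∸ y) + (y ∸ x) ≡ 0 → x ≡ y
m∸n+n∸m≡0⇒m≡n x y d≡0 =
  ≤-antisym (m∸n≡0⇒m≤n (m+n≡0⇒m≡0 (x ∸ y) d≡0)) (m∸n≡0⇒m≤n (m+n≡0⇒n≡0 (x ∸ y) d≡0))

χ≡-refl : ∀ x → χ≡ x x ≡ 1
χ≡-refl x = cong (λ d → 1 ∸ (d + d)) (n∸n≡0 x)

≢⇒χ≡≡0 : ∀ {x y} → x ≢ y → χ≡ x y ≡ 0
≢⇒χ≡≡0 {x} {y} x≢y = n>0⇒1∸n≡0 _ (n≢0⇒n>0 (λ d≡0 → x≢y (m∸n+n∸m≡0⇒m≡n x y d≡0)))

χ≡>0⇒≡ : ∀ x y → 0 < χ≡ x y → x ≡ y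
χ≡>0⇒≡ x y p = m∸n+n∸m≡0⇒m≡n x y (1∸n>0⇒n≡0 _ p)

n>0⇒sg≡1 : ∀ {x} → 0 < x → sg x ≡ 1
n>0⇒sg≡1 {x} 0<x = cong (1 ∸_) (n>0⇒1∸n≡0 x 0<x)

sg>0⇒n>0 : ∀ x → 0 < sg x → 0 < x
sg>0⇒n>0 zero    ()
sg>0⇒n>0 (suc x) _ = z<s

sg-reflects : ∀ x {b} → (b ≡ true → 0 < x) → (0 < x → b ≡ true) → sg x ≡ toℕ b
sg-reflects zero    {false} _ _ = refl
sg-reflects zero    {true}  b⇒ _ with () ← b⇒ refl
sg-reflects (suc x) {true}  _ _ = n>0⇒sg≡1 {suc x} z<s
sg-reflects (suc x) {false} _ ⇒b with () ← ⇒b z<s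

m*n>0⇒m>0∧n>0 : ∀ x y → 0 < x * y → 0 < x × 0 < y
m*n>0⇒m>0∧n>0 (suc x) (suc y) _ = z<s , z<s
m*n>0⇒m>0∧n>0 (suc x) zero    p = ⊥-elim (<-irrefl (sym (*-zeroʳ x)) p)

count-partialSums≤ : ∀ N (v : ℕ → ℕ) r₀ → r₀ < N → v r₀ ≡ 1 →
                     ∑< N (λ r → χ≤ (∑< (suc r) v) (∑< r₀ v)) ≡ r₀
count-partialSums≤ N v r₀ r₀<N vr₀≡1 =
  trans (∑<-tail r₀ N (<⇒≤ r₀<N) (λ r r₀≤r _ → ≰⇒χ≤≡0 (beyond r r₀≤r)))
        (∑<-ones r₀ (λ r r<r₀ → ≤⇒χ≤≡1 (∑<-mono-bound v r<r₀)))
  where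
  beyond : ∀ r → r₀ ≤ r → ¬ ∑< (suc r) v ≤ ∑< r₀ v
  beyond r r₀≤r ≤partial = <-irrefl refl (begin-strict
    ∑< r₀ v             <⟨ m<m+n _ (subst (0 <_) (sym vr₀≡1) z<s) ⟩
    ∑< r₀ v + v r₀      ≤⟨ ∑<-mono-bound v (s≤s r₀≤r) ⟩
    ∑< (suc r) v        ≤⟨ ≤partial ⟩
    ∑< r₀ v             ∎)
    where open ≤-Reasoning

rank : Str → ℕ
rank []      = 0
rank (b ∷ τ) = toℕ b + 2 * rank τ

fromRank : ℕ → ℕ → Str
fromRank zero    r = []
fromRank (suc L) r = isOdd r ∷ fromRank L ⌊ r /2⌋

isOdd-double : ∀ x → isOdd (2 * x) ≡ false
isOdd-double zero    = refl
isOdd-double (suc x) = trans (cong (λ y → not (isOdd y)) (+-suc x (x + 0))) (trans (not-involutive _) (isOdd-double x))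

⌊double/2⌋ : ∀ x → ⌊ 2 * x /2⌋ ≡ x
⌊double/2⌋ zero    = refl
⌊double/2⌋ (suc x) = trans (cong (λ y → ⌊ suc y /2⌋) (+-suc x (x + 0))) (cong suc (⌊double/2⌋ x))

isOdd-digit : ∀ b x → isOdd (toℕ b + 2 * x) ≡ b
isOdd-digit false x = isOdd-double x
isOdd-digit true  x = cong not (isOdd-double x)

⌊digit/2⌋ : ∀ b x → ⌊ toℕ b + 2 * x /2⌋ ≡ x
⌊digit/2⌋ false x = ⌊double/2⌋ x
⌊digit/2⌋ true  x = begin
  ⌊ suc (2 * x) /2⌋                   ≡⟨ ⌊suc/2⌋ (2 * x) ⟩
  ⌊ 2 * x /2⌋ + toℕ (isOdd (2 * x))   ≡⟨ cong₂ (λ h b → h + toℕ b) (⌊double/2⌋ x) (isOdd-double x) ⟩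
  x + 0                               ≡⟨ +-identityʳ x ⟩
  x                                   ∎
  where open ≡-Reasoning

digit-decomposition : ∀ r → toℕ (isOdd r) + 2 * ⌊ r /2⌋ ≡ r
digit-decomposition zero          = refl
digit-decomposition (suc zero)    = refl
digit-decomposition (suc (suc r)) = begin
  toℕ (not (not (isOdd r))) + 2 * suc ⌊ r /2⌋   ≡⟨ cong (λ b → toℕ b + 2 * suc ⌊ r /2⌋) (not-involutive (isOdd r)) ⟩
  toℕ (isOdd r) + 2 * suc ⌊ r /2⌋               ≡⟨ shift (toℕ (isOdd r)) ⌊ r /2⌋ ⟩
  suc (suc (toℕ (isOdd r) + 2 * ⌊ r /2⌋))       ≡⟨ cong (λ n → suc (suc n)) (digit-decomposition r) ⟩
  suc (suc r)                                   ∎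
  where open ≡-Reasoning
        shift : ∀ a h → a + 2 * suc h ≡ suc (suc (a + 2 * h))
        shift = solve-∀

length-fromRank : ∀ L r → length (fromRank L r) ≡ L
length-fromRank zero    r = refl
length-fromRank (suc L) r = cong suc (length-fromRank L ⌊ r /2⌋)

fromRank-rank : ∀ τ → fromRank (length τ) (rank τ) ≡ τ
fromRank-rank []      = refl
fromRank-rank (b ∷ τ) = cong₂ _∷_ (isOdd-digit b (rank τ))
                                  (trans (cong (fromRank (length τ)) (⌊digit/2⌋ b (rank τ))) (fromRank-rank τ))

⌊/2⌋<2^ : ∀ L r → r < 2 ^ suc L → ⌊ r /2⌋ < 2 ^ L
⌊/2⌋<2^ L r r<2^1+L = *-cancelˡ-< 2 ⌊ r /2⌋ (2 ^ L) (begin-strict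
  2 * ⌊ r /2⌋                    ≤⟨ m≤n+m _ (toℕ (isOdd r)) ⟩
  toℕ (isOdd r) + 2 * ⌊ r /2⌋    ≡⟨ digit-decomposition r ⟩
  r                              <⟨ r<2^1+L ⟩
  2 * 2 ^ L                      ∎)
  where open ≤-Reasoning

rank-fromRank : ∀ L r → r < 2 ^ L → rank (fromRank L r) ≡ r
rank-fromRank zero    zero    _   = refl
rank-fromRank zero    (suc r) (s≤s ())
rank-fromRank (suc L) r       r<  = trans (cong (λ x → toℕ (isOdd r) + 2 * x) (rank-fromRank L ⌊ r /2⌋ (⌊/2⌋<2^ L r r<)))
                                          (digit-decomposition r)

rank<2^length : ∀ τ → rank τ < 2 ^ length τ
rank<2^length []      = z<s
rank<2^length (b ∷ τ) = begin-strict
  toℕ b + 2 * rank τ    ≤⟨ +-monoˡ-≤ (2 * rank τ) (toℕ≤1 b) ⟩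
  1 + 2 * rank τ        <⟨ n<1+n _ ⟩
  2 + 2 * rank τ        ≡⟨ *-suc 2 (rank τ) ⟨
  2 * suc (rank τ)      ≤⟨ *-monoʳ-≤ 2 (rank<2^length τ) ⟩
  2 * 2 ^ length τ      ∎
  where open ≤-Reasoning

rank-injective : ∀ σ τ → length σ ≡ length τ → rank σ ≡ rank τ → σ ≡ τ
rank-injective σ τ |σ|≡|τ| rankσ≡rankτ = begin
  σ                                  ≡⟨ fromRank-rank σ ⟨
  fromRank (length σ) (rank σ)       ≡⟨ cong₂ fromRank |σ|≡|τ| rankσ≡rankτ ⟩
  fromRank (length τ) (rank τ)       ≡⟨ fromRank-rank τ ⟩
  τ                                  ∎
  where open ≡-Reasoning

rank-++ : ∀ σ τ → rank (σ ++ τ) ≡ rank σ + 2 ^ length σ * rank τ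
rank-++ []      τ = sym (+-identityʳ (rank τ))
rank-++ (b ∷ σ) τ = begin
  toℕ b + 2 * rank (σ ++ τ)                              ≡⟨ cong (λ x → toℕ b + 2 * x) (rank-++ σ τ) ⟩
  toℕ b + 2 * (rank σ + 2 ^ length σ * rank τ)           ≡⟨ regroup (toℕ b) (rank σ) (2 ^ length σ) (rank τ) ⟩
  (toℕ b + 2 * rank σ) + (2 * 2 ^ length σ) * rank τ     ∎
  where open ≡-Reasoning
        regroup : ∀ d r p t → d + 2 * (r + p * t) ≡ (d + 2 * r) + (2 * p) * t
        regroup = solve-∀

fromRank-unique : ∀ σ {L r} → length σ ≡ L → rank σ ≡ r → fromRank L r ≡ σ
fromRank-unique σ refl refl = fromRank-rank σ

fromRank-++ : ∀ L i q s → i ≤ L → q < 2 ^ i → s < 2 ^ (L ∸ i) →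
              fromRank L (q + 2 ^ i * s) ≡ fromRank i q ++ fromRank (L ∸ i) s
fromRank-++ L i q s i≤L q< s< = fromRank-unique (ρ ++ ρ′) length≡ rank≡
  where
  ρ = fromRank i q
  ρ′ = fromRank (L ∸ i) s
  length≡ : length (ρ ++ ρ′) ≡ L
  length≡ = trans (length-++ ρ) (trans (cong₂ _+_ (length-fromRank i q) (length-fromRank (L ∸ i) s)) (m+[n∸m]≡n i≤L))
  rank≡ : rank (ρ ++ ρ′) ≡ q + 2 ^ i * s
  rank≡ = begin
    rank (ρ ++ ρ′)
      ≡⟨ rank-++ ρ ρ′ ⟩
    rank ρ + 2 ^ length ρ * rank ρ′
      ≡⟨ cong₂ (λ l r′ → rank ρ + 2 ^ l * r′) (length-fromRank i q) (rank-fromRank (L ∸ i) s s<) ⟩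
    rank ρ + 2 ^ i * s
      ≡⟨ cong (_+ 2 ^ i * s) (rank-fromRank i q q<) ⟩
    q + 2 ^ i * s
      ∎
    where open ≡-Reasoning

encode-∷ : ∀ b σ → encode (b ∷ σ) ≡ suc (toℕ b + 2 * encode σ)
encode-∷ false σ = refl
encode-∷ true  σ = refl

suc-encode : ∀ σ → suc (encode σ) ≡ 2 ^ length σ + rank σ
suc-encode []      = refl
suc-encode (b ∷ σ) = begin
  suc (encode (b ∷ σ))                           ≡⟨ cong suc (encode-∷ b σ) ⟩
  suc (suc (toℕ b + 2 * encode σ))               ≡⟨ regroup (toℕ b) (encode σ) ⟩
  toℕ b + 2 * suc (encode σ)                     ≡⟨ cong (λ x → toℕ b + 2 * x) (suc-encode σ) ⟩
  toℕ b + 2 * (2 ^ length σ + rank σ)            ≡⟨ regroup′ (toℕ b) (2 ^ length σ) (rank σ) ⟩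
  2 * 2 ^ length σ + (toℕ b + 2 * rank σ)        ∎
  where open ≡-Reasoning
        regroup : ∀ d e → suc (suc (d + 2 * e)) ≡ d + 2 * suc e
        regroup = solve-∀
        regroup′ : ∀ d p r → d + 2 * (p + r) ≡ 2 * p + (d + 2 * r)
        regroup′ = solve-∀

length≤encode : ∀ σ → length σ ≤ encode σ
length≤encode []      = z≤n
length≤encode (b ∷ σ) = begin
  suc (length σ)               ≤⟨ s≤s (length≤encode σ) ⟩
  suc (encode σ)               ≤⟨ s≤s (≤-trans (m≤m+n (encode σ) _) (m≤n+m _ (toℕ b))) ⟩
  suc (toℕ b + 2 * encode σ)   ≡⟨ encode-∷ b σ ⟨
  encode (b ∷ σ)               ∎
  where open ≤-Reasoning

2^-cancel-< : ∀ {a b} → 2 ^ a < 2 ^ b → a < b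
2^-cancel-< {a} {b} 2^a<2^b with a <? b
... | yes a<b = a<b
... | no  a≮b = contradiction 2^a<2^b (≤⇒≯ (^-monoʳ-≤ 2 (≮⇒≥ a≮b)))

2^length≤suc-encode : ∀ σ → 2 ^ length σ ≤ suc (encode σ)
2^length≤suc-encode σ = ≤-trans (m≤m+n _ (rank σ)) (≤-reflexive (sym (suc-encode σ)))

suc-encode<2^suc-length : ∀ σ → suc (encode σ) < 2 ^ suc (length σ)
suc-encode<2^suc-length σ = begin-strict
  suc (encode σ)               ≡⟨ suc-encode σ ⟩
  2 ^ length σ + rank σ        <⟨ +-monoʳ-< (2 ^ length σ) (rank<2^length σ) ⟩
  2 ^ length σ + 2 ^ length σ  ≡⟨ cong (2 ^ length σ +_) (+-identityʳ (2 ^ length σ)) ⟨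
  2 ^ suc (length σ)           ∎
  where open ≤-Reasoning

-- the number of strings of length ≤ ℓ: encode enumerates strings by length
codeBound : ℕ → ℕ
codeBound ℓ = 2 ^ suc ℓ ∸ 1

<codeBound⇔ : ∀ s ℓ → s < codeBound ℓ ⇔ suc s < 2 ^ suc ℓ
<codeBound⇔ s ℓ = mk⇔ (to (2 ^ suc ℓ)) (from (2 ^ suc ℓ))
  where
  to : ∀ a → s < a ∸ 1 → suc s < a
  to (suc a) s<a = s≤s s<a
  from : ∀ a → suc s < a → s < a ∸ 1
  from (suc a) (s≤s s<a) = s<a

encode<codeBound⇒length≤ : ∀ σ ℓ → encode σ < codeBound ℓ → length σ ≤ ℓ
encode<codeBound⇒length≤ σ ℓ code< =
  s≤s⁻¹ (2^-cancel-< (≤-<-trans (2^length≤suc-encode σ) (Equivalence.to (<codeBound⇔ (encode σ) ℓ) code<)))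

length≤⇒encode<codeBound : ∀ σ ℓ → length σ ≤ ℓ → encode σ < codeBound ℓ
length≤⇒encode<codeBound σ ℓ |σ|≤ℓ =
  Equivalence.from (<codeBound⇔ (encode σ) ℓ) (<-≤-trans (suc-encode<2^suc-length σ) (^-monoʳ-≤ 2 (s≤s |σ|≤ℓ)))

length≡-from-code : ∀ σ ℓ → 2 ^ ℓ ≤ suc (encode σ) → encode σ < codeBound ℓ → length σ ≡ ℓ
length≡-from-code σ ℓ ≤code code< =
  ≤-antisym (encode<codeBound⇒length≤ σ ℓ code<) (s≤s⁻¹ (2^-cancel-< (≤-<-trans ≤code (suc-encode<2^suc-length σ))))

encode-injective : ∀ σ τ → encode σ ≡ encode τ → σ ≡ τ
encode-injective σ τ eq = rank-injective σ τ |σ|≡|τ| rankσ≡rankτ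
  where
  open ≡-Reasoning
  |σ|≡|τ| : length σ ≡ length τ
  |σ|≡|τ| = length≡-from-code σ (length τ)
    (subst (λ e → 2 ^ length τ ≤ suc e) (sym eq) (2^length≤suc-encode τ))
    (subst (_< codeBound (length τ)) (sym eq) (length≤⇒encode<codeBound τ (length τ) ≤-refl))
  rankσ≡rankτ : rank σ ≡ rank τ
  rankσ≡rankτ = +-cancelˡ-≡ (2 ^ length τ) (rank σ) (rank τ) (begin
    2 ^ length τ + rank σ   ≡⟨ cong (λ l → 2 ^ l + rank σ) |σ|≡|τ| ⟨
    2 ^ length σ + rank σ   ≡⟨ suc-encode σ ⟨
    suc (encode σ)          ≡⟨ cong suc eq ⟩
    suc (encode τ)          ≡⟨ suc-encode τ ⟩
    2 ^ length τ + rank τ   ∎)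

decodeWithFuel : ℕ → ℕ → Str
decodeWithFuel zero    s       = []
decodeWithFuel (suc f) zero    = []
decodeWithFuel (suc f) (suc s) = isOdd s ∷ decodeWithFuel f ⌊ s /2⌋

decode : ℕ → Str
decode s = decodeWithFuel s s

encode-decodeWithFuel : ∀ f s → s ≤ f → encode (decodeWithFuel f s) ≡ s
encode-decodeWithFuel zero    zero    _ = refl
encode-decodeWithFuel (suc f) zero    _ = refl
encode-decodeWithFuel (suc f) (suc s) (s≤s s≤f) = begin
  encode (isOdd s ∷ decodeWithFuel f ⌊ s /2⌋)
    ≡⟨ encode-∷ (isOdd s) _ ⟩
  suc (toℕ (isOdd s) + 2 * encode (decodeWithFuel f ⌊ s /2⌋))
    ≡⟨ cong (λ x → suc (toℕ (isOdd s) + 2 * x)) (encode-decodeWithFuel f ⌊ s /2⌋ (≤-trans (⌊n/2⌋≤n s) s≤f)) ⟩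
  suc (toℕ (isOdd s) + 2 * ⌊ s /2⌋)
    ≡⟨ cong suc (digit-decomposition s) ⟩
  suc s
    ∎
  where open ≡-Reasoning

encode-decode : ∀ s → encode (decode s) ≡ s
encode-decode s = encode-decodeWithFuel s s ≤-refl

ones : ℕ → Str
ones c = replicate c true

encode-ones-++ : ∀ c σ → 2 + encode (ones c ++ σ) ≡ 2 ^ c * (2 + encode σ)
encode-ones-++ zero    σ = sym (*-identityˡ _)
encode-ones-++ (suc c) σ = begin
  2 + suc (1 + 2 * encode (ones c ++ σ))   ≡⟨ regroup (encode (ones c ++ σ)) ⟩
  2 * (2 + encode (ones c ++ σ))           ≡⟨ cong (2 *_) (encode-ones-++ c σ) ⟩
  2 * (2 ^ c * (2 + encode σ))             ≡⟨ *-assoc 2 (2 ^ c) _ ⟨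
  2 ^ suc c * (2 + encode σ)               ∎
  where open ≡-Reasoning
        regroup : ∀ e → 2 + suc (1 + 2 * e) ≡ 2 * (2 + e)
        regroup = solve-∀

2+encode-false∷ : ∀ u → 2 + encode (false ∷ u) ≡ suc (2 * suc (encode u))
2+encode-false∷ u = regroup (encode u)
  where regroup : ∀ e → 2 + suc (2 * e) ≡ suc (2 * suc e)
        regroup = solve-∀

2^*odd-unique : ∀ a b x y → 2 ^ a * suc (2 * x) ≡ 2 ^ b * suc (2 * y) → a ≡ b × x ≡ y
2^*odd-unique zero    zero    x y eq =
  refl , *-cancelˡ-≡ x y 2 (suc-injective (trans (sym (*-identityˡ _)) (trans eq (*-identityˡ _))))
2^*odd-unique (suc a) zero    x y eq =
  contradiction (trans (sym (*-assoc 2 (2 ^ a) _)) (trans eq (*-identityˡ _))) (even≢odd (2 ^ a * suc (2 * x)) y)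
2^*odd-unique zero    (suc b) x y eq with 2^*odd-unique (suc b) zero y x (sym eq)
... | () , _
2^*odd-unique (suc a) (suc b) x y eq
  with 2^*odd-unique a b x y (*-cancelˡ-≡ _ _ 2 (trans (sym (*-assoc 2 (2 ^ a) _)) (trans eq (*-assoc 2 (2 ^ b) _))))
... | refl , x≡y = refl , x≡y

ones-false-prefix : ∀ a b u v (ρ : Str) → (ones a ++ false ∷ u) ++ ρ ≡ ones b ++ false ∷ v → a ≡ b × v ≡ u ++ ρ
ones-false-prefix zero    zero    u v ρ eq = refl , sym (proj₂ (∷-injective eq))
ones-false-prefix (suc a) (suc b) u v ρ eq with ones-false-prefix a b u v ρ (proj₂ (∷-injective eq))
... | refl , v≡uρ = refl , v≡uρ

encode≡2^∸1+rank : ∀ σ → encode σ ≡ 2 ^ length σ ∸ 1 + rank σ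
encode≡2^∸1+rank σ = begin
  encode σ                       ≡⟨ cong (_∸ 1) (suc-encode σ) ⟩
  2 ^ length σ + rank σ ∸ 1      ≡⟨ +-∸-comm (rank σ) (m^n>0 2 (length σ)) ⟩
  2 ^ length σ ∸ 1 + rank σ      ∎
  where open ≡-Reasoning

count : (Str → Bool) → List Str → ℕ
count Q []       = 0
count Q (τ ∷ τs) = toℕ (Q τ) + count Q τs

length-filterᵇ : ∀ Q τs → length (filterᵇ Q τs) ≡ count Q τs
length-filterᵇ Q []       = refl
length-filterᵇ Q (τ ∷ τs) with Q τ
... | true  = cong suc (length-filterᵇ Q τs)
... | false = length-filterᵇ Q τs

children : Str → List Str
children τ = (false ∷ τ) ∷ (true ∷ τ) ∷ []

count-children : ∀ Q τs →
                 count Q (concatMap children τs) ≡ count (λ τ → Q (false ∷ τ)) τs + count (λ τ → Q (true ∷ τ)) τs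
count-children Q []       = refl
count-children Q (τ ∷ τs) =
  trans (cong (λ c → toℕ (Q (false ∷ τ)) + (toℕ (Q (true ∷ τ)) + c)) (count-children Q τs))
        (regroup (toℕ (Q (false ∷ τ))) (toℕ (Q (true ∷ τ))) _ _)
  where regroup : ∀ a b c d → a + (b + (c + d)) ≡ (a + c) + (b + d)
        regroup = solve-∀

fromRank-digit : ∀ L b r → fromRank (suc L) (toℕ b + 2 * r) ≡ b ∷ fromRank L r
fromRank-digit L b r = cong₂ _∷_ (isOdd-digit b r) (cong (fromRank L) (⌊digit/2⌋ b r))

count-strings : ∀ L Q → count Q (strings L) ≡ ∑< (2 ^ L) (λ r → toℕ (Q (fromRank L r)))
count-strings zero    Q = +-identityʳ (toℕ (Q []))
count-strings (suc L) Q = begin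
  count Q (strings (suc L))
    ≡⟨ count-children Q (strings L) ⟩
  count (λ τ → Q (false ∷ τ)) (strings L) + count (λ τ → Q (true ∷ τ)) (strings L)
    ≡⟨ cong₂ _+_ (count-strings L (λ τ → Q (false ∷ τ))) (count-strings L (λ τ → Q (true ∷ τ))) ⟩
  ∑< (2 ^ L) (λ r → toℕ (Q (false ∷ fromRank L r))) + ∑< (2 ^ L) (λ r → toℕ (Q (true ∷ fromRank L r)))
    ≡⟨ ∑<-distrib-+ (2 ^ L) _ _ ⟩
  ∑< (2 ^ L) (λ r → toℕ (Q (false ∷ fromRank L r)) + toℕ (Q (true ∷ fromRank L r)))
    ≡⟨ ∑<-cong (2 ^ L) (λ r _ → cong₂ _+_ (cong (toℕ ∘ Q) (fromRank-digit L false r))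
                                          (cong (toℕ ∘ Q) (fromRank-digit L true r))) ⟨
  ∑< (2 ^ L) (λ r → toℕ (Q (fromRank (suc L) (2 * r))) + toℕ (Q (fromRank (suc L) (suc (2 * r)))))
    ≡⟨ ∑<-pairs (2 ^ L) (λ r → toℕ (Q (fromRank (suc L) r))) ⟨
  ∑< (2 ^ suc L) (λ r → toℕ (Q (fromRank (suc L) r)))
    ∎
  where open ≡-Reasoning

hasPrefixIn : ℕ → Str → Bool
hasPrefixIn k τ = any (λ ρ → bit k (encode ρ)) (inits τ)

cylCount-as-∑< : ∀ k L → cylCount k L ≡ ∑< (2 ^ L) (λ r → toℕ (hasPrefixIn k (fromRank L r)))
cylCount-as-∑< k L = trans (length-filterᵇ (hasPrefixIn k) (strings L)) (count-strings L (hasPrefixIn k))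

any-map : ∀ (h : Str → Bool) (g : Str → Str) τs → any h (map g τs) ≡ any (h ∘ g) τs
any-map h g []       = refl
any-map h g (τ ∷ τs) = cong (h (g τ) ∨_) (any-map h g τs)

any-inits⇒prefix : ∀ (h : Str → Bool) τ → any h (inits τ) ≡ true →
                   Σ Str λ ρ → Σ Str λ ρ′ → τ ≡ ρ ++ ρ′ × h ρ ≡ true
any-inits⇒prefix h τ any≡true with h [] in h[]
any-inits⇒prefix h τ       _ | true  = [] , τ , refl , h[]
any-inits⇒prefix h (b ∷ τ) p | false with any-inits⇒prefix (h ∘ (b ∷_)) τ (trans (sym (any-map h (b ∷_) (inits τ))) p)
... | ρ , ρ′ , τ≡ρρ′ , hbρ = b ∷ ρ , ρ′ , cong (b ∷_) τ≡ρρ′ , hbρ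

prefix⇒any-inits : ∀ (h : Str → Bool) ρ ρ′ → h ρ ≡ true → any h (inits (ρ ++ ρ′)) ≡ true
prefix⇒any-inits h []      ρ′ hρ rewrite hρ = refl
prefix⇒any-inits h (b ∷ ρ) ρ′ hρ =
  trans (cong (h [] ∨_) (trans (any-map h (b ∷_) (inits (ρ ++ ρ′))) (prefix⇒any-inits (h ∘ (b ∷_)) ρ ρ′ hρ)))
        (∨-zeroʳ (h []))

-- If the last point is selected it takes some value h N < M; renaming the value M′ = M - 1 to h N
-- turns h on the remaining selected points into an injection into M′.
injection⇒count≤ : ∀ N M (P : ℕ → Bool) (h : ℕ → ℕ) →
  (∀ r → r < N → P r ≡ true → h r < M) →
  (∀ r r′ → r < N → r′ < N → P r ≡ true → P r′ ≡ true → h r ≡ h r′ → r ≡ r′) →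
  ∑< N (toℕ ∘ P) ≤ M
injection⇒count≤ zero    M P h bounded injective = z≤n
injection⇒count≤ (suc N) M P h bounded injective with P N in PN
... | false = subst (_≤ M) (sym (+-identityʳ _))
                (injection⇒count≤ N M P h (λ r r<N → bounded r (m<n⇒m<1+n r<N))
                   (λ r r′ r<N r′<N → injective r r′ (m<n⇒m<1+n r<N) (m<n⇒m<1+n r′<N)))
... | true with bounded N ≤-refl PN
...   | hN<M@(s≤s {n = M′} _) =
  subst (_≤ suc M′) (+-comm 1 _) (s≤s (injection⇒count≤ N M′ P h′ bounded′ injective′))
  where
  h′ : ℕ → ℕ
  h′ r with h r ≟ M′
  ... | yes _ = h N
  ... | no  _ = h r
  h≢hN : ∀ r → r < N → P r ≡ true → h r ≢ h N
  h≢hN r r<N Pr hr≡hN = <-irrefl (injective r N (m<n⇒m<1+n r<N) ≤-refl Pr PN hr≡hN) r<N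
  bounded′ : ∀ r → r < N → P r ≡ true → h′ r < M′
  bounded′ r r<N Pr with h r ≟ M′
  ... | yes hr≡M′ = ≤∧≢⇒< (s≤s⁻¹ hN<M) (λ hN≡M′ → h≢hN r r<N Pr (trans hr≡M′ (sym hN≡M′)))
  ... | no  hr≢M′ = ≤∧≢⇒< (s≤s⁻¹ (bounded r (m<n⇒m<1+n r<N) Pr)) hr≢M′
  injective′ : ∀ r r′ → r < N → r′ < N → P r ≡ true → P r′ ≡ true → h′ r ≡ h′ r′ → r ≡ r′
  injective′ r r′ r<N r′<N Pr Pr′ eq with h r ≟ M′ | h r′ ≟ M′
  ... | yes hr≡M′ | yes hr′≡M′ =
    injective r r′ (m<n⇒m<1+n r<N) (m<n⇒m<1+n r′<N) Pr Pr′ (trans hr≡M′ (sym hr′≡M′))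
  ... | no  _     | no  _      = injective r r′ (m<n⇒m<1+n r<N) (m<n⇒m<1+n r′<N) Pr Pr′ eq
  ... | yes _     | no  _      = contradiction (sym eq) (h≢hN r′ r′<N Pr′)
  ... | no  _     | yes _      = contradiction eq (h≢hN r r<N Pr)

injection⇒count-strings≤ : ∀ L L′ (Q : Str → Bool) (w : Str → Str) →
  (∀ τ → length τ ≡ L → Q τ ≡ true → length (w τ) ≡ L′) →
  (∀ τ τ′ → length τ ≡ L → length τ′ ≡ L → Q τ ≡ true → Q τ′ ≡ true → w τ ≡ w τ′ → τ ≡ τ′) →
  ∑< (2 ^ L) (λ r → toℕ (Q (fromRank L r))) ≤ 2 ^ L′
injection⇒count-strings≤ L L′ Q w length-w w-injective =
  injection⇒count≤ (2 ^ L) (2 ^ L′) (Q ∘ fromRank L) (rank ∘ w ∘ fromRank L) bounded injective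
  where
  length-w′ : ∀ r → Q (fromRank L r) ≡ true → length (w (fromRank L r)) ≡ L′
  length-w′ r = length-w (fromRank L r) (length-fromRank L r)
  bounded : ∀ r → r < 2 ^ L → Q (fromRank L r) ≡ true → rank (w (fromRank L r)) < 2 ^ L′
  bounded r _ Qτ = subst (λ l → rank (w (fromRank L r)) < 2 ^ l) (length-w′ r Qτ) (rank<2^length (w (fromRank L r)))
  injective : ∀ r r′ → r < 2 ^ L → r′ < 2 ^ L → Q (fromRank L r) ≡ true → Q (fromRank L r′) ≡ true →
              rank (w (fromRank L r)) ≡ rank (w (fromRank L r′)) → r ≡ r′
  injective r r′ r<2^L r′<2^L Qτ Qτ′ rank-eq = begin
    r                        ≡⟨ rank-fromRank L r r<2^L ⟨
    rank (fromRank L r)      ≡⟨ cong rank (w-injective _ _ (length-fromRank L r) (length-fromRank L r′) Qτ Qτ′ w-eq) ⟩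
    rank (fromRank L r′)     ≡⟨ rank-fromRank L r′ r′<2^L ⟩
    r′                       ∎
    where
    open ≡-Reasoning
    w-eq : w (fromRank L r) ≡ w (fromRank L r′)
    w-eq = rank-injective _ _ (trans (length-w′ r Qτ) (sym (length-w′ r′ Qτ′))) rank-eq

bit-digit-suc : ∀ b x p → bit (toℕ b + 2 * x) (suc p) ≡ bit x p
bit-digit-suc b x p = cong (λ y → bit y p) (⌊digit/2⌋ b x)

bit-zero : ∀ p → bit 0 p ≡ false
bit-zero zero    = refl
bit-zero (suc p) = bit-zero p

bit⇒2^≤ : ∀ k p → bit k p ≡ true → 2 ^ p ≤ k
bit⇒2^≤ (suc k) zero    _   = s≤s z≤n
bit⇒2^≤ k       (suc p) bit≡true = begin
  2 * 2 ^ p                   ≤⟨ *-monoʳ-≤ 2 (bit⇒2^≤ ⌊ k /2⌋ p bit≡true) ⟩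
  2 * ⌊ k /2⌋                 ≤⟨ m≤n+m _ (toℕ (isOdd k)) ⟩
  toℕ (isOdd k) + 2 * ⌊ k /2⌋ ≡⟨ digit-decomposition k ⟩
  k                           ∎
  where open ≤-Reasoning

n<2^n : ∀ n → n < 2 ^ n
n<2^n zero    = z<s
n<2^n (suc n) = begin-strict
  suc n          ≤⟨ n<2^n n ⟩
  2 ^ n          <⟨ m<m+n (2 ^ n) (m^n>0 2 n) ⟩
  2 ^ n + 2 ^ n  ≡⟨ cong (2 ^ n +_) (+-identityʳ (2 ^ n)) ⟨
  2 ^ suc n      ∎
  where open ≤-Reasoning

∈D⇒length< : ∀ σ k → σ ∈D k → length σ < k
∈D⇒length< σ k σ∈k = <-≤-trans (≤-<-trans (length≤encode σ) (n<2^n (encode σ))) (bit⇒2^≤ k (encode σ) σ∈k)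

binary : ℕ → (ℕ → ℕ) → ℕ
binary N c = ∑< N (λ r → c r * 2 ^ r)

binary-suc : ∀ N c → binary (suc N) c ≡ c 0 + 2 * binary N (λ r → c (suc r))
binary-suc N c = begin
  ∑< (suc N) (λ r → c r * 2 ^ r)                     ≡⟨ ∑<-shift N (λ r → c r * 2 ^ r) ⟩
  c 0 * 1 + ∑< N (λ r → c (suc r) * (2 * 2 ^ r))     ≡⟨ cong₂ _+_ (*-identityʳ (c 0))
                                                         (∑<-cong N (λ r _ → regroup (c (suc r)) (2 ^ r))) ⟩
  c 0 + ∑< N (λ r → 2 * (c (suc r) * 2 ^ r))         ≡⟨ cong (c 0 +_) (*-distribˡ-∑< 2 N (λ r → c (suc r) * 2 ^ r)) ⟨
  c 0 + 2 * ∑< N (λ r → c (suc r) * 2 ^ r)           ∎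
  where open ≡-Reasoning
        regroup : ∀ a p → a * (2 * p) ≡ 2 * (a * p)
        regroup = solve-∀

≤1⇒toℕ : ∀ {x} → x ≤ 1 → Σ Bool λ b → x ≡ toℕ b
≤1⇒toℕ z≤n       = false , refl
≤1⇒toℕ (s≤s z≤n) = true , refl

bit-binary⁻ : ∀ N c p → (∀ r → c r ≤ 1) → bit (binary N c) p ≡ true → p < N × c p ≡ 1
bit-binary⁻ zero    c p c≤1 bit≡true with () ← trans (sym (bit-zero p)) bit≡true
bit-binary⁻ (suc N) c p c≤1 bit≡true with ≤1⇒toℕ (c≤1 0)
... | b , c0≡b rewrite binary-suc N c | c0≡b with p
...   | zero  rewrite isOdd-digit b (binary N (λ r → c (suc r))) = z<s , trans c0≡b (cong toℕ bit≡true)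
...   | suc p with bit-binary⁻ N (λ r → c (suc r)) p (λ r → c≤1 (suc r))
                   (trans (sym (bit-digit-suc b _ p)) bit≡true)
...     | p<N , cp≡1 = s≤s p<N , cp≡1

bit-binary⁺ : ∀ N c p → (∀ r → c r ≤ 1) → p < N → c p ≡ 1 → bit (binary N c) p ≡ true
bit-binary⁺ (suc N) c p c≤1 p<1+N cp≡1 with ≤1⇒toℕ (c≤1 0)
... | b , c0≡b rewrite binary-suc N c | c0≡b with p
...   | zero  = trans (isOdd-digit b (binary N (λ r → c (suc r)))) (toℕ>0⇒true (≤-reflexive (trans (sym cp≡1) c0≡b)))
...   | suc p = trans (bit-digit-suc b (binary N (λ r → c (suc r))) p)
                      (bit-binary⁺ N (λ r → c (suc r)) p (λ r → c≤1 (suc r)) (s≤s⁻¹ p<1+N) cp≡1)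

++-comparable : ∀ (σ τ x y : Str) → σ ++ x ≡ τ ++ y →
                (Σ Str λ ρ → τ ≡ σ ++ ρ) ⊎ (Σ Str λ ρ → σ ≡ τ ++ ρ)
++-comparable []      τ       x y eq = inj₁ (τ , refl)
++-comparable (b ∷ σ) []      x y eq = inj₂ (b ∷ σ , refl)
++-comparable (b ∷ σ) (c ∷ τ) x y eq with ∷-injective eq
... | refl , eq′ with ++-comparable σ τ x y eq′
...   | inj₁ (ρ , τ≡σρ) = inj₁ (ρ , cong (b ∷_) τ≡σρ)
...   | inj₂ (ρ , σ≡τρ) = inj₂ (ρ , cong (b ∷_) σ≡τρ)

prefixFree-extension : ∀ m → PrefixFree m → ∀ σ ρ → Converges m σ → Converges m (σ ++ ρ) → σ ≡ σ ++ ρ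
prefixFree-extension m prefixFree σ ρ ⇓σ ⇓σρ with ≡-dec Bool._≟_ σ (σ ++ ρ)
... | yes σ≡σρ = σ≡σρ
... | no  σ≢σρ = contradiction (⇓σ , ⇓σρ) (prefixFree σ ρ σ≢σρ)

prefixFree-comparable : ∀ m → PrefixFree m → ∀ σ τ {x y} → σ ++ x ≡ τ ++ y →
                        Converges m σ → Converges m τ → σ ≡ τ
prefixFree-comparable m prefixFree σ τ {x} {y} eq ⇓σ ⇓τ with ++-comparable σ τ x y eq
... | inj₁ (ρ , refl) = prefixFree-extension m prefixFree σ ρ ⇓σ ⇓τ
... | inj₂ (ρ , refl) = sym (prefixFree-extension m prefixFree τ ρ ⇓τ ⇓σ)

length-↾ : ∀ (X : Real) n → length (X ↾ n) ≡ n
length-↾ X n = trans (length-map X (upTo n)) (length-upTo n)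

↾-extends : ∀ (X : Real) {n} L → n ≤ L → Σ Str λ ρ → X ↾ L ≡ X ↾ n ++ ρ
↾-extends X L n≤L with m≤n⇒m<n∨m≡n n≤L
... | inj₂ refl = [] , sym (++-identityʳ (X ↾ L))
↾-extends X {n} (suc L) _ | inj₁ n<1+L with ↾-extends X L (s≤s⁻¹ n<1+L)
... | ρ , X↾L≡ = ρ ++ X L ∷ [] , (begin
  map X (upTo (suc L))          ≡⟨ cong (map X) (upTo-∷ʳ L) ⟨
  map X (upTo L ++ L ∷ [])      ≡⟨ map-++ X (upTo L) (L ∷ []) ⟩
  X ↾ L ++ X L ∷ []             ≡⟨ cong (_++ X L ∷ []) X↾L≡ ⟩
  (X ↾ n ++ ρ) ++ X L ∷ []      ≡⟨ ++-assoc (X ↾ n) ρ (X L ∷ []) ⟩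
  X ↾ n ++ (ρ ++ X L ∷ [])      ∎)
  where open ≡-Reasoning

take-length-++ : ∀ (σ τ : Str) → take (length σ) (σ ++ τ) ≡ σ
take-length-++ []      τ = refl
take-length-++ (b ∷ σ) τ = cong (b ∷_) (take-length-++ σ τ)

Outputs⇒Converges : ∀ m {σ τ} → Outputs m σ τ → Converges m σ
Outputs⇒Converges m out ⇓≡0 = 0≢1+n (trans (sym ⇓≡0) out)

-- From a prefix-free machine to a test

module TestFromMachine (m f : PR 1) where

  F : ℕ → ℕ
  F n = ⟦ f ⟧₁ n

  programCount : ℕ → ℕ → ℕ
  programCount n t = ∑< (codeBound (F n ∸ n)) (λ s → χ≡ (⟦ m ⟧₁ s) (suc t))

  -- t codes a string of length F n (2 ^ F n ≤ t + 1, t < codeBound (F n)) that is output on some code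
  -- below codeBound (F n ∸ n), i.e. by a program of length ≤ F n ∸ n
  member : ℕ → ℕ → ℕ
  member n t = χ≤ (2 ^ F n) (suc t) * (χ≤ n (F n) * sg (programCount n t))

  testIndex : ℕ → ℕ
  testIndex n = binary (codeBound (F n)) (member n)

  testᴱ : Expr 1
  testᴱ = sum (pow2 (lit 1 ⊕ app f (var zero)) ⊖ lit 1) (memberᴱ ⊗ pow2 (var zero))
    where
    n t : Expr 2
    n = var (suc zero)
    t = var zero
    programCountᴱ : Expr 2
    programCountᴱ = sum (pow2 (lit 1 ⊕ (app f n ⊖ n)) ⊖ lit 1) (χ≡ᴱ (app m (var zero)) (lit 1 ⊕ var (suc zero)))
    memberᴱ : Expr 2
    memberᴱ = χ≤ᴱ (pow2 (app f n)) (lit 1 ⊕ t) ⊗ (χ≤ᴱ n (app f n) ⊗ sgᴱ programCountᴱ)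

  opaque
    test : PR 1
    test = compile testᴱ

    test-correct : ∀ n → ⟦ test ⟧₁ n ≡ testIndex n
    test-correct n = compile-correct testᴱ (n ∷ [])

  member≤1 : ∀ n t → member n t ≤ 1
  member≤1 n t =
    *-mono-≤ (m∸n≤m 1 (2 ^ F n ∸ suc t)) (*-mono-≤ (m∸n≤m 1 (n ∸ F n)) (m∸n≤m 1 (1 ∸ programCount n t)))

  member⁻ : ∀ n t → member n t ≡ 1 →
            2 ^ F n ≤ suc t × n ≤ F n × Σ ℕ λ s → s < codeBound (F n ∸ n) × ⟦ m ⟧₁ s ≡ suc t
  member⁻ n t member≡1 with m*n>0⇒m>0∧n>0 _ _ (subst (0 <_) (sym member≡1) z<s)
  ... | lengthOk , rest with m*n>0⇒m>0∧n>0 _ _ rest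
  ...   | n≤Fn , programs with ∑<>0⇒term>0 (codeBound (F n ∸ n)) _ (sg>0⇒n>0 _ programs)
  ...     | s , s< , ms≡ = χ≤>0⇒≤ _ _ lengthOk , χ≤>0⇒≤ _ _ n≤Fn , s , s< , χ≡>0⇒≡ _ _ ms≡

  member⁺ : ∀ n t {s} → 2 ^ F n ≤ suc t → n ≤ F n → s < codeBound (F n ∸ n) → ⟦ m ⟧₁ s ≡ suc t →
            member n t ≡ 1
  member⁺ n t {s} lengthOk n≤Fn s< ms≡ =
    cong₂ _*_ (≤⇒χ≤≡1 lengthOk) (cong₂ _*_ (≤⇒χ≤≡1 n≤Fn) (n>0⇒sg≡1 programs))
    where
    programs : 0 < programCount n t
    programs = <-≤-trans (subst (0 <_) (sym (trans (cong (λ y → χ≡ y (suc t)) ms≡) (χ≡-refl (suc t)))) z<s)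
                         (term≤∑< (codeBound (F n ∸ n)) (λ s → χ≡ (⟦ m ⟧₁ s) (suc t)) s<)

  ∈test⁻ : ∀ n σ → σ ∈D testIndex n → length σ ≡ F n × CBound m σ (F n) n
  ∈test⁻ n σ σ∈ with bit-binary⁻ (codeBound (F n)) (member n) (encode σ) (member≤1 n) σ∈
  ... | code< , member≡1 with member⁻ n (encode σ) member≡1
  ...   | lengthOk , n≤Fn , s , s< , ms≡ = length≡-from-code σ (F n) lengthOk code< , decode s , out , short
    where
    out : Outputs m (decode s) σ
    out = trans (cong ⟦ m ⟧₁ (encode-decode s)) ms≡
    short : length (decode s) + n ≤ F n
    short = begin
      length (decode s) + n  ≤⟨ +-monoˡ-≤ n (encode<codeBound⇒length≤ (decode s) (F n ∸ n)
                                             (subst (_< codeBound (F n ∸ n)) (sym (encode-decode s)) s<)) ⟩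
      F n ∸ n + n            ≡⟨ m∸n+n≡m n≤Fn ⟩
      F n                    ∎
      where open ≤-Reasoning

  ∈test⁺ : ∀ n σ → length σ ≡ F n → CBound m σ (F n) n → σ ∈D testIndex n
  ∈test⁺ n σ |σ|≡Fn (σ′ , out , short) =
    bit-binary⁺ (codeBound (F n)) (member n) (encode σ) (member≤1 n)
      (length≤⇒encode<codeBound σ (F n) (≤-reflexive |σ|≡Fn))
      (member⁺ n (encode σ) (subst (λ l → 2 ^ l ≤ suc (encode σ)) |σ|≡Fn (2^length≤suc-encode σ))
         (m+n≤o⇒n≤o (length σ′) short)
         (length≤⇒encode<codeBound σ′ (F n ∸ n) (m+n≤o⇒m≤o∸n (length σ′) short)) out)

  covers : (X : Real) → (∀ c → CBound m (X ↾ F c) (F c) c) → ∀ n → X ∈[D ⟦ test ⟧₁ n ]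
  covers X compressible n =
    X ↾ F n ,
    subst (λ k → (X ↾ F n) ∈D k) (sym (test-correct n)) (∈test⁺ n (X ↾ F n) (length-↾ X (F n)) (compressible n)) ,
    cong (X ↾_) (length-↾ X (F n))

  cylinder⇒compressible-head : ∀ n τ → hasPrefixIn (testIndex n) τ ≡ true → F n ≤ length τ × CBound m (take (F n) τ) (F n) n
  cylinder⇒compressible-head n τ inCylinder with any-inits⇒prefix (λ ρ → bit (testIndex n) (encode ρ)) τ inCylinder
  ... | ρ , ρ′ , refl , ρ∈ with ∈test⁻ n ρ ρ∈
  ...   | |ρ|≡Fn , short = Fn≤ , subst (λ σ → CBound m σ (F n) n) (sym take≡ρ) short
    where
    Fn≤ : F n ≤ length (ρ ++ ρ′)
    Fn≤ = subst (_≤ length (ρ ++ ρ′)) |ρ|≡Fn (≤-trans (m≤m+n _ _) (≤-reflexive (sym (length-++ ρ))))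
    take≡ρ : take (F n) (ρ ++ ρ′) ≡ ρ
    take≡ρ = subst (λ l → take l (ρ ++ ρ′) ≡ ρ) |ρ|≡Fn (take-length-++ ρ ρ′)

  module Compression (prefixFree : PrefixFree m) (n : ℕ) where

    InCylinder : Str → Set
    InCylinder τ = hasPrefixIn (testIndex n) τ ≡ true

    programCode : Str → ℕ
    programCode τ = search (λ s → ⟦ m ⟧₁ s ≟ suc (encode (take (F n) τ))) (codeBound (F n ∸ n))

    program : Str → Str
    program τ = decode (programCode τ)

    program-correct : ∀ τ → InCylinder τ → Outputs m (program τ) (take (F n) τ) × length (program τ) ≤ F n ∸ n
    program-correct τ inCylinder with cylinder⇒compressible-head n τ inCylinder
    ... | _ , σ′ , out , short with search-correct (λ s → ⟦ m ⟧₁ s ≟ suc (encode (take (F n) τ))) (codeBound (F n ∸ n))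
                                      (length≤⇒encode<codeBound σ′ (F n ∸ n) (m+n≤o⇒m≤o∸n (length σ′) short)) out
    ...   | code< , found =
            trans (cong ⟦ m ⟧₁ (encode-decode (programCode τ))) found ,
            encode<codeBound⇒length≤ (program τ) (F n ∸ n) (subst (_< codeBound (F n ∸ n)) (sym (encode-decode _)) code<)

    cylinder-bounds : ∀ τ → InCylinder τ → n ≤ F n × F n ≤ length τ
    cylinder-bounds τ inCylinder with cylinder⇒compressible-head n τ inCylinder
    ... | Fn≤ , σ′ , _ , short = m+n≤o⇒n≤o (length σ′) short , Fn≤

    padding : Str → Str
    padding τ = replicate (F n ∸ n ∸ length (program τ)) false

    compress : Str → Str
    compress τ = program τ ++ (padding τ ++ drop (F n) τ)

    length-compress : ∀ τ → InCylinder τ → length (compress τ) + n ≡ length τ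
    length-compress τ inCylinder = begin
      length (program τ ++ (padding τ ++ drop (F n) τ)) + n
        ≡⟨ cong (_+ n) (trans (length-++ (program τ)) (cong (length (program τ) +_) (length-++ (padding τ)))) ⟩
      length (program τ) + (length (padding τ) + length (drop (F n) τ)) + n
        ≡⟨ cong (λ p → length (program τ) + (p + length (drop (F n) τ)) + n) (length-replicate _) ⟩
      length (program τ) + (F n ∸ n ∸ length (program τ) + length (drop (F n) τ)) + n
        ≡⟨ cong (_+ n) (+-assoc (length (program τ)) _ _) ⟨
      length (program τ) + (F n ∸ n ∸ length (program τ)) + length (drop (F n) τ) + n
        ≡⟨ cong (λ p → p + length (drop (F n) τ) + n) (m+[n∸m]≡n |program|≤) ⟩
      F n ∸ n + length (drop (F n) τ) + n
        ≡⟨ +-comm-middle (F n ∸ n) (length (drop (F n) τ)) n ⟩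
      (F n ∸ n + n) + length (drop (F n) τ)
        ≡⟨ cong₂ _+_ (m∸n+n≡m n≤Fn) (length-drop (F n) τ) ⟩
      F n + (length τ ∸ F n)
        ≡⟨ m+[n∸m]≡n Fn≤ ⟩
      length τ
        ∎
      where
      open ≡-Reasoning
      |program|≤ = proj₂ (program-correct τ inCylinder)
      n≤Fn = proj₁ (cylinder-bounds τ inCylinder)
      Fn≤ = proj₂ (cylinder-bounds τ inCylinder)
      +-comm-middle : ∀ a b c → a + b + c ≡ (a + c) + b
      +-comm-middle = solve-∀

    compress-injective : ∀ τ τ′ → InCylinder τ → InCylinder τ′ → compress τ ≡ compress τ′ → τ ≡ τ′
    compress-injective τ τ′ inCylinder inCylinder′ eq = begin
      τ                                  ≡⟨ take++drop≡id (F n) τ ⟨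
      take (F n) τ ++ drop (F n) τ       ≡⟨ cong₂ _++_ heads tails ⟩
      take (F n) τ′ ++ drop (F n) τ′     ≡⟨ take++drop≡id (F n) τ′ ⟩
      τ′                                 ∎
      where
      open ≡-Reasoning
      out = proj₁ (program-correct τ inCylinder)
      out′ = proj₁ (program-correct τ′ inCylinder′)
      programs : program τ ≡ program τ′
      programs = prefixFree-comparable m prefixFree (program τ) (program τ′) eq
                   (Outputs⇒Converges m out) (Outputs⇒Converges m out′)
      heads : take (F n) τ ≡ take (F n) τ′
      heads = encode-injective _ _ (suc-injective (trans (sym out) (trans (cong (⟦ m ⟧₁ ∘ encode) programs) out′)))
      paddings : padding τ ≡ padding τ′
      paddings = cong (λ p → replicate (F n ∸ n ∸ length p) false) programs
      tails : drop (F n) τ ≡ drop (F n) τ′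
      tails = ++-cancelˡ (padding τ) _ _ (trans
                (++-cancelˡ (program τ) _ _ (trans eq (cong (_++ (padding τ′ ++ drop (F n) τ′)) (sym programs))))
                (cong (_++ drop (F n) τ′) (sym paddings)))

    cylCount≤ : ∀ L → cylCount (testIndex n) L * 2 ^ n ≤ 2 ^ L
    cylCount≤ L with n ≤? L
    ... | yes n≤L = begin
      cylCount (testIndex n) L * 2 ^ n
        ≡⟨ cong (_* 2 ^ n) (cylCount-as-∑< (testIndex n) L) ⟩
      ∑< (2 ^ L) (λ r → toℕ (hasPrefixIn (testIndex n) (fromRank L r))) * 2 ^ n
        ≤⟨ *-monoˡ-≤ (2 ^ n) (injection⇒count-strings≤ L (L ∸ n) (hasPrefixIn (testIndex n)) compress
                                (λ τ |τ|≡L inCylinder → trans (sym (m+n∸n≡m _ n))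
                                                              (cong (_∸ n) (trans (length-compress τ inCylinder) |τ|≡L)))
                                (λ τ τ′ _ _ → compress-injective τ τ′)) ⟩
      2 ^ (L ∸ n) * 2 ^ n
        ≡⟨ ^-distribˡ-+-* 2 (L ∸ n) n ⟨
      2 ^ (L ∸ n + n)
        ≡⟨ cong (2 ^_) (m∸n+n≡m n≤L) ⟩
      2 ^ L
        ∎
      where open ≤-Reasoning
    ... | no n≰L =
      subst (λ c → c * 2 ^ n ≤ 2 ^ L) (sym (trans (cylCount-as-∑< (testIndex n) L) (∑<-zero (2 ^ L) outside))) z≤n
      where
      outside : ∀ r → r < 2 ^ L → toℕ (hasPrefixIn (testIndex n) (fromRank L r)) ≡ 0
      outside r _ with hasPrefixIn (testIndex n) (fromRank L r) in inCylinder
      ... | false = refl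
      ... | true  = contradiction (≤-trans n≤Fn (subst (F n ≤_) (length-fromRank L r) Fn≤)) n≰L
        where
        n≤Fn = proj₁ (cylinder-bounds (fromRank L r) inCylinder)
        Fn≤ = proj₂ (cylinder-bounds (fromRank L r) inCylinder)

  isTest : PrefixFree m → IsPRTest test
  isTest prefixFree n L _ =
    subst (λ k → cylCount k L * 2 ^ n ≤ 2 ^ L) (sym (test-correct n)) (Compression.cylCount≤ prefixFree n L)

-- From a test to a prefix-free machine

module MachineFromTest (g : PR 1) where

  K : ℕ → ℕ
  K c = ⟦ g ⟧₁ (2 + 2 * c)

  L : ℕ → ℕ
  L c = K c + (2 + 2 * c)

  -- number of ways to write fromRank (L c) r as fromRank i q ++ fromRank (L c ∸ i) s with the head in G_{2c+2};
  -- 2 ^ i ∸ 1 + q is the code of the head (encode≡2^∸1+rank)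
  prefixWitnesses : ℕ → ℕ → ℕ
  prefixWitnesses c r =
    ∑< (suc (L c)) λ i → ∑< (2 ^ i) λ q → ∑< (2 ^ (L c ∸ i)) λ s →
      χ≡ r (q + 2 ^ i * s) * toℕ (bit (K c) (2 ^ i ∸ 1 + q))

  valid : ℕ → ℕ → ℕ
  valid c r = sg (prefixWitnesses c r)

  cylinderSize : ℕ → ℕ
  cylinderSize c = ∑< (2 ^ L c) (valid c)

  -- the rank of the j-th string of length L c in the cylinder (count-partialSums≤)
  selected : ℕ → ℕ → ℕ
  selected c j = ∑< (2 ^ L c) (λ r → χ≤ (∑< (suc r) (valid c)) j)

  output : ℕ → ℕ → ℕ
  output c j = 2 ^ L c ∸ 1 + selected c j

  index : ℕ → ℕ → ℕ
  index c j = 2 ^ K c + j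

  -- the program ones c ++ false ∷ fromRank (K c) j has code e with 2 + e = 2 ^ c * (2 * index c j + 1)
  machine : ℕ → ℕ
  machine e = ∑< (2 + e) λ c → ∑< (cylinderSize c) λ j → χ≡ (2 + e) (2 ^ c * suc (2 * index c j)) * suc (output c j)

  Kᴱ Lᴱ : ∀ {k} → Expr k → Expr k
  Kᴱ c = app g (lit 2 ⊕ lit 2 ⊗ c)
  Lᴱ c = Kᴱ c ⊕ (lit 2 ⊕ lit 2 ⊗ c)

  validᴱ : ∀ {k} → Expr k → Expr k → Expr k
  validᴱ c r = sgᴱ (sum (lit 1 ⊕ Lᴱ c) (sum (pow2 i₁) (sum (pow2 (Lᴱ (weaken (weaken c)) ⊖ i₂))
                 (χ≡ᴱ (weaken (weaken (weaken r))) (q ⊕ pow2 i₃ ⊗ s) ⊗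
                  bitᴱ (Kᴱ (weaken (weaken (weaken c)))) (pow2 i₃ ⊖ lit 1 ⊕ q)))))
    where
    i₁ = var zero
    i₂ = var (suc zero)
    i₃ = var (suc (suc zero))
    q  = var (suc zero)
    s  = var zero

  cylinderSizeᴱ : ∀ {k} → Expr k → Expr k
  cylinderSizeᴱ c = sum (pow2 (Lᴱ c)) (validᴱ (weaken c) (var zero))

  outputᴱ : ∀ {k} → Expr k → Expr k → Expr k
  outputᴱ c j = (pow2 (Lᴱ c) ⊖ lit 1) ⊕ sum (pow2 (Lᴱ c))
                  (χ≤ᴱ (sum (lit 1 ⊕ var zero) (validᴱ (weaken (weaken c)) (var zero))) (weaken j))

  machineᴱ : Expr 1
  machineᴱ = sum (lit 2 ⊕ var zero) (sum (cylinderSizeᴱ (var zero))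
               (χ≡ᴱ (lit 2 ⊕ e) (pow2 c ⊗ (lit 1 ⊕ lit 2 ⊗ (pow2 (Kᴱ c) ⊕ j))) ⊗ (lit 1 ⊕ outputᴱ c j)))
    where
    j = var zero
    c = var (suc zero)
    e = var (suc (suc zero))

  opaque
    machineP : PR 1
    machineP = compile machineᴱ

    machineP-correct : ∀ e → ⟦ machineP ⟧₁ e ≡ machine e
    machineP-correct e = compile-correct machineᴱ (e ∷ [])

    lengthP : PR 1
    lengthP = compile (Lᴱ (var zero))

    lengthP-correct : ∀ c → ⟦ lengthP ⟧₁ c ≡ L c
    lengthP-correct c = compile-correct (Lᴱ (var zero)) (c ∷ [])

  witness⇒prefix : ∀ c r → 0 < prefixWitnesses c r → hasPrefixIn (K c) (fromRank (L c) r) ≡ true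
  witness⇒prefix c r witnesses>0
    with ∑<>0⇒term>0 (suc (L c)) _ witnesses>0
  ... | i , i<1+L , pos₁ with ∑<>0⇒term>0 (2 ^ i) _ pos₁
  ... | q , q<2^i , pos₂ with ∑<>0⇒term>0 (2 ^ (L c ∸ i)) _ pos₂
  ... | s , s<2^L-i , pos₃ with m*n>0⇒m>0∧n>0 (χ≡ r (q + 2 ^ i * s)) _ pos₃
  ... | split , inG = subst (λ τ → hasPrefixIn (K c) τ ≡ true) (sym fromRank≡)
                        (prefix⇒any-inits (λ ρ → bit (K c) (encode ρ)) ρ ρ′ ρ∈G)
    where
    ρ = fromRank i q
    ρ′ = fromRank (L c ∸ i) s
    fromRank≡ : fromRank (L c) r ≡ ρ ++ ρ′
    fromRank≡ = trans (cong (fromRank (L c)) (χ≡>0⇒≡ _ _ split)) (fromRank-++ (L c) i q s (s≤s⁻¹ i<1+L) q<2^i s<2^L-i)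
    encodeρ : encode ρ ≡ 2 ^ i ∸ 1 + q
    encodeρ = trans (encode≡2^∸1+rank ρ) (cong₂ (λ l r → 2 ^ l ∸ 1 + r) (length-fromRank i q) (rank-fromRank i q q<2^i))
    ρ∈G : bit (K c) (encode ρ) ≡ true
    ρ∈G = subst (λ x → bit (K c) x ≡ true) (sym encodeρ) (toℕ>0⇒true inG)

  prefix⇒witness : ∀ c r → r < 2 ^ L c → hasPrefixIn (K c) (fromRank (L c) r) ≡ true → 0 < prefixWitnesses c r
  prefix⇒witness c r r< inCylinder with any-inits⇒prefix (λ ρ → bit (K c) (encode ρ)) (fromRank (L c) r) inCylinder
  ... | ρ , ρ′ , fromRank≡ , ρ∈G = begin-strict
    0                         <⟨ subst (0 <_) (sym term≡1) z<s ⟩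
    term i q s                ≤⟨ term≤∑< (2 ^ (L c ∸ i)) (term i q) s< ⟩
    ∑< (2 ^ (L c ∸ i)) (term i q)
                              ≤⟨ term≤∑< (2 ^ i) (λ q → ∑< (2 ^ (L c ∸ i)) (term i q)) q< ⟩
    ∑< (2 ^ i) (λ q → ∑< (2 ^ (L c ∸ i)) (term i q))
      ≤⟨ term≤∑< (suc (L c)) (λ i → ∑< (2 ^ i) (λ q → ∑< (2 ^ (L c ∸ i)) (term i q))) (s≤s i≤L) ⟩
    prefixWitnesses c r       ∎
    where
    open ≤-Reasoning
    term : ℕ → ℕ → ℕ → ℕ
    term i q s = χ≡ r (q + 2 ^ i * s) * toℕ (bit (K c) (2 ^ i ∸ 1 + q))
    i = length ρ
    q = rank ρ
    s = rank ρ′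
    length≡ : i + length ρ′ ≡ L c
    length≡ = trans (sym (length-++ ρ)) (trans (cong length (sym fromRank≡)) (length-fromRank (L c) r))
    i≤L : i ≤ L c
    i≤L = subst (i ≤_) length≡ (m≤m+n i _)
    q< : q < 2 ^ i
    q< = rank<2^length ρ
    s< : s < 2 ^ (L c ∸ i)
    s< = subst (λ l → s < 2 ^ l) (trans (sym (m+n∸m≡n i (length ρ′))) (cong (_∸ i) length≡)) (rank<2^length ρ′)
    r≡ : r ≡ q + 2 ^ i * s
    r≡ = trans (sym (rank-fromRank (L c) r r<)) (trans (cong rank fromRank≡) (rank-++ ρ ρ′))
    term≡1 : term i q s ≡ 1
    term≡1 = cong₂ _*_ (trans (cong (λ x → χ≡ x (q + 2 ^ i * s)) r≡) (χ≡-refl (q + 2 ^ i * s)))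
                       (cong toℕ (trans (cong (bit (K c)) (sym (encode≡2^∸1+rank ρ))) ρ∈G))

  valid-correct : ∀ c r → r < 2 ^ L c → valid c r ≡ toℕ (hasPrefixIn (K c) (fromRank (L c) r))
  valid-correct c r r< = sg-reflects (prefixWitnesses c r) (prefix⇒witness c r r<) (witness⇒prefix c r)

  cylinderSize-correct : ∀ c → cylinderSize c ≡ cylCount (K c) (L c)
  cylinderSize-correct c = trans (∑<-cong (2 ^ L c) (valid-correct c)) (sym (cylCount-as-∑< (K c) (L c)))

  program : ℕ → ℕ → Str
  program c j = ones c ++ false ∷ fromRank (K c) j

  length-program : ∀ c j → length (program c j) + c ≡ suc (K c + 2 * c)
  length-program c j = begin
    length (ones c ++ false ∷ fromRank (K c) j) + c        ≡⟨ cong (_+ c) (length-++ (ones c)) ⟩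
    length (ones c) + suc (length (fromRank (K c) j)) + c
      ≡⟨ cong₂ (λ a b → a + suc b + c) (length-replicate c) (length-fromRank (K c) j) ⟩
    c + suc (K c) + c                                      ≡⟨ regroup c (K c) ⟩
    suc (K c + 2 * c)                                      ∎
    where open ≡-Reasoning
          regroup : ∀ c k → c + suc k + c ≡ suc (k + 2 * c)
          regroup = solve-∀

  2+encode-program : ∀ c j → j < 2 ^ K c → 2 + encode (program c j) ≡ 2 ^ c * suc (2 * index c j)
  2+encode-program c j j< = begin
    2 + encode (ones c ++ false ∷ fromRank (K c) j)      ≡⟨ encode-ones-++ c _ ⟩
    2 ^ c * (2 + encode (false ∷ fromRank (K c) j))      ≡⟨ cong (2 ^ c *_) (2+encode-false∷ _) ⟩
    2 ^ c * suc (2 * suc (encode (fromRank (K c) j)))    ≡⟨ cong (λ x → 2 ^ c * suc (2 * x)) (suc-encode _) ⟩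
    2 ^ c * suc (2 * (2 ^ length (fromRank (K c) j) + rank (fromRank (K c) j)))
      ≡⟨ cong₂ (λ l r → 2 ^ c * suc (2 * (2 ^ l + r))) (length-fromRank (K c) j) (rank-fromRank (K c) j j<) ⟩
    2 ^ c * suc (2 * index c j)                          ∎
    where open ≡-Reasoning

  machine-converges : ∀ e → machine e ≢ 0 →
                      Σ ℕ λ c → Σ ℕ λ j → j < cylinderSize c × 2 + e ≡ 2 ^ c * suc (2 * index c j)
  machine-converges e converges with ∑<>0⇒term>0 (2 + e) _ (n≢0⇒n>0 converges)
  ... | c , _ , pos with ∑<>0⇒term>0 (cylinderSize c) _ pos
  ... | j , j< , pos′ = c , j , j< , χ≡>0⇒≡ _ _ (proj₁ (m*n>0⇒m>0∧n>0 _ (suc (output c j)) pos′))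

  machine-output : ∀ e c j → j < cylinderSize c → 2 + e ≡ 2 ^ c * suc (2 * index c j) → machine e ≡ suc (output c j)
  machine-output e c j j< code≡ = begin
    machine e                        ≡⟨ ∑<-single (2 + e) c c<2+e otherPrefixLengths ⟩
    ∑< (cylinderSize c) (term c)     ≡⟨ ∑<-single (cylinderSize c) j j< otherIndices ⟩
    term c j                         ≡⟨ cong (_* suc (output c j)) (trans (cong (λ x → χ≡ x code) code≡) (χ≡-refl code)) ⟩
    1 * suc (output c j)             ≡⟨ *-identityˡ _ ⟩
    suc (output c j)                 ∎
    where
    open ≡-Reasoning
    code = 2 ^ c * suc (2 * index c j)
    term : ℕ → ℕ → ℕ
    term c′ j′ = χ≡ (2 + e) (2 ^ c′ * suc (2 * index c′ j′)) * suc (output c′ j′)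
    term-off : ∀ c′ j′ → 2 + e ≢ 2 ^ c′ * suc (2 * index c′ j′) → term c′ j′ ≡ 0
    term-off c′ j′ code≢ = cong (_* suc (output c′ j′)) (≢⇒χ≡≡0 code≢)
    same-code : ∀ c′ j′ → 2 + e ≡ 2 ^ c′ * suc (2 * index c′ j′) → c′ ≡ c × index c′ j′ ≡ index c j
    same-code c′ j′ code≡′ = 2^*odd-unique c′ c (index c′ j′) (index c j) (trans (sym code≡′) code≡)
    otherPrefixLengths : ∀ c′ → c′ < 2 + e → c′ ≢ c → ∑< (cylinderSize c′) (term c′) ≡ 0
    otherPrefixLengths c′ _ c′≢c = ∑<-zero (cylinderSize c′) (λ j′ _ → term-off c′ j′ (c′≢c ∘ proj₁ ∘ same-code c′ j′))
    otherIndices : ∀ j′ → j′ < cylinderSize c → j′ ≢ j → term c j′ ≡ 0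
    otherIndices j′ _ j′≢j = term-off c j′ (j′≢j ∘ +-cancelˡ-≡ (2 ^ K c) j′ j ∘ proj₂ ∘ same-code c j′)
    c<2+e : c < 2 + e
    c<2+e = <-≤-trans (n<2^n c) (≤-trans (m≤m*n (2 ^ c) (suc (2 * index c j))) (≤-reflexive (sym code≡)))

  program-extension : ∀ c j c′ j′ ρ → program c j ++ ρ ≡ program c′ j′ → ρ ≡ []
  program-extension c j c′ j′ ρ eq with ones-false-prefix c c′ (fromRank (K c) j) (fromRank (K c′) j′) ρ eq
  ... | refl , u′≡uρ = length≡0⇒[] (+-cancelˡ-≡ (K c) (length ρ) 0 (begin
    K c + length ρ                          ≡⟨ cong (_+ length ρ) (length-fromRank (K c) j) ⟨
    length (fromRank (K c) j) + length ρ    ≡⟨ length-++ (fromRank (K c) j) ⟨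
    length (fromRank (K c) j ++ ρ)          ≡⟨ cong length u′≡uρ ⟨
    length (fromRank (K c) j′)              ≡⟨ length-fromRank (K c) j′ ⟩
    K c                                     ≡⟨ +-identityʳ (K c) ⟨
    K c + 0                                 ∎))
    where open ≡-Reasoning
          length≡0⇒[] : ∀ {ρ : Str} → length ρ ≡ 0 → ρ ≡ []
          length≡0⇒[] {[]} _ = refl

  module _ (isTest : IsPRTest g) where

    cylinderSize≤ : ∀ c → cylinderSize c ≤ 2 ^ K c
    cylinderSize≤ c = *-cancelʳ-≤ (cylinderSize c) (2 ^ K c) (2 ^ (2 + 2 * c)) {{m^n≢0 2 (2 + 2 * c)}} (begin
      cylinderSize c * 2 ^ (2 + 2 * c)     ≡⟨ cong (_* 2 ^ (2 + 2 * c)) (cylinderSize-correct c) ⟩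
      cylCount (K c) (L c) * 2 ^ (2 + 2 * c)
        ≤⟨ isTest (2 + 2 * c) (L c) (λ σ σ∈ → ≤-trans (<⇒≤ (∈D⇒length< σ (K c) σ∈)) (m≤m+n _ _)) ⟩
      2 ^ L c                              ≡⟨ ^-distribˡ-+-* 2 (K c) (2 + 2 * c) ⟩
      2 ^ K c * 2 ^ (2 + 2 * c)            ∎)
      where open ≤-Reasoning

    code⇒program : ∀ σ c j → j < cylinderSize c → 2 + encode σ ≡ 2 ^ c * suc (2 * index c j) → σ ≡ program c j
    code⇒program σ c j j< code≡ = encode-injective σ (program c j) (+-cancelˡ-≡ 2 (encode σ) (encode (program c j))
      (trans code≡ (sym (2+encode-program c j (<-≤-trans j< (cylinderSize≤ c))))))

    converges⇒program : ∀ σ → Converges machineP σ → Σ ℕ λ c → Σ ℕ λ j → j < cylinderSize c × σ ≡ program c j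
    converges⇒program σ converges =
      let c , j , j< , code≡ = machine-converges (encode σ)
                                 (λ machine≡0 → converges (trans (machineP-correct (encode σ)) machine≡0))
      in  c , j , j< , code⇒program σ c j j< code≡

    prefixFree : PrefixFree machineP
    prefixFree σ ρ σ≢σρ (⇓σ , ⇓σρ) =
      let c  , j  , _ , σ≡  = converges⇒program σ ⇓σ
          c′ , j′ , _ , σρ≡ = converges⇒program (σ ++ ρ) ⇓σρ
      in  σ≢σρ (sym (trans (cong (σ ++_) (program-extension c j c′ j′ ρ (trans (cong (_++ ρ) (sym σ≡)) σρ≡)))
                           (++-identityʳ σ)))

    compressible : (X : Real) → (∀ n → X ∈[D ⟦ g ⟧₁ n ]) → ∀ c → CBound machineP (X ↾ L c) (L c) c
    compressible X covered c = program c j , outputs , short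
      where
      σ₀ = proj₁ (covered (2 + 2 * c))
      σ₀∈ = proj₁ (proj₂ (covered (2 + 2 * c)))
      X↾≡σ₀ = proj₂ (proj₂ (covered (2 + 2 * c)))
      τ = X ↾ L c
      |τ|≡L : length τ ≡ L c
      |τ|≡L = length-↾ X (L c)
      inCylinder : hasPrefixIn (K c) τ ≡ true
      inCylinder =
        let ρ , τ≡ = ↾-extends X (L c) (≤-trans (<⇒≤ (∈D⇒length< σ₀ (K c) σ₀∈)) (m≤m+n (K c) _))
        in  subst (λ τ′ → hasPrefixIn (K c) τ′ ≡ true) (sym (trans τ≡ (cong (_++ ρ) X↾≡σ₀)))
                  (prefix⇒any-inits (λ ρ → bit (K c) (encode ρ)) σ₀ ρ σ₀∈)
      r₀ = rank τ
      r₀< : r₀ < 2 ^ L c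
      r₀< = subst (λ l → r₀ < 2 ^ l) |τ|≡L (rank<2^length τ)
      valid≡1 : valid c r₀ ≡ 1
      valid≡1 = trans (valid-correct c r₀ r₀<)
                      (cong toℕ (trans (cong (hasPrefixIn (K c)) (fromRank-unique τ |τ|≡L refl)) inCylinder))
      j = ∑< r₀ (valid c)
      j< : j < cylinderSize c
      j< = <-≤-trans (m<m+n j (subst (0 <_) (sym valid≡1) z<s)) (∑<-mono-bound (valid c) r₀<)
      output≡ : output c j ≡ encode τ
      output≡ = begin
        2 ^ L c ∸ 1 + selected c j   ≡⟨ cong (2 ^ L c ∸ 1 +_) (count-partialSums≤ (2 ^ L c) (valid c) r₀ r₀< valid≡1) ⟩
        2 ^ L c ∸ 1 + r₀             ≡⟨ cong (λ l → 2 ^ l ∸ 1 + r₀) |τ|≡L ⟨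
        2 ^ length τ ∸ 1 + r₀        ≡⟨ encode≡2^∸1+rank τ ⟨
        encode τ                     ∎
        where open ≡-Reasoning
      outputs : Outputs machineP (program c j) τ
      outputs = trans (machineP-correct _)
                  (trans (machine-output _ c j j< (2+encode-program c j (<-≤-trans j< (cylinderSize≤ c)))) (cong suc output≡))
      short : length (program c j) + c ≤ L c
      short = begin
        length (program c j) + c   ≡⟨ length-program c j ⟩
        suc (K c + 2 * c)          ≤⟨ n≤1+n _ ⟩
        suc (suc (K c + 2 * c))    ≡⟨ regroup (K c) c ⟩
        K c + (2 + 2 * c)          ∎
        where open ≤-Reasoning
              regroup : ∀ k c → suc (suc (k + 2 * c)) ≡ k + (2 + 2 * c)
              regroup = solve-∀

proposition2p9 : (X : Real) → BPRandom X ⇔ PFBPRandom X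
proposition2p9 X = mk⇔ BP⇒PFBP PFBP⇒BP
  where
  BP⇒PFBP : BPRandom X → PFBPRandom X
  BP⇒PFBP random (m , prefixFree , f , compressible) =
    random (test m f) (isTest m f prefixFree) (covers m f X compressible)
    where open TestFromMachine
  PFBP⇒BP : PFBPRandom X → BPRandom X
  PFBP⇒BP random g isTest covered =
    random (machineP g , prefixFree g isTest , lengthP g ,
            λ c → subst (λ l → CBound (machineP g) (X ↾ l) l c) (sym (lengthP-correct g c))
                        (compressible g isTest X covered c))
    where open MachineFromTest
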